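{- Let $W$ be the Weyl group of type $E_8$ with simple reflections $S$, let $u,v\in W$ with $AD(u,v)\neq\emptyset$ and let $t$ be a minimal element of $AD(u,v)$ with respect to $\preceq$. If $t\notin S$, then there exists $s\in S$ such that $s\in D(t)$, $s^t=tst$ is minimal in $AD(us,vs)$, and $s^t=t^s$ where $t^s=sts$. Moreover, $s\in D_R(u)$ if and only if $s\in D_R(v)$.
   Context: $W$ acts as a reflection group with root system of type $E_8$ and simple roots $\{\alpha_s: s\in S\}$; each reflection $t\in T$ has positive root $\alpha_t$, and $r\preceq t$ iff $\alpha_t-\alpha_r$ is a nonnegative combination of simple roots. $D(w)=\{t\in T: wt<w\}$, $A(w)=\{t\in T: w<wt\}$ (Bruhat order), $AD(u,v)=A(u)\cap D(v)$, $D_R(w)=\{s\in S:\ell(ws)<\ell(w)\}$. -}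

module Defs where

open import Data.Nat as ℕ using (ℕ; zero; suc)
open import Data.Integer using (ℤ; +_; -_; _+_; _*_; _-_; _≤_)
open import Data.Fin using (Fin; zero; suc; toℕ; _≟_)
open import Data.List using (List; []; _∷_; length)
open import Data.Bool using (Bool; true; false; if_then_else_)
open import Data.Product using (_×_; ∃; ∃₂)
open import Function using (_∘_)
open import Relation.Nullary using (does)
open import Relation.Binary.PropositionalEquality using (_≡_)
open import Relation.Binary.Construct.Closure.Transitive using (TransClosure)

-- Vectors of the ambient space, written in the basis of simple roots α_0 … α_7.
Vec8 : Set
Vec8 = Fin 8 → ℤ

∑ : ∀ {n} → (Fin n → ℤ) → ℤ
∑ {zero} f = + 0
∑ {suc n} f = f zero + ∑ (λ i → f (suc i))

-- Dynkin diagram of E8 (Bourbaki numbering 1..8 shifted to 0..7):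
-- edges 1-3, 2-4, 3-4, 4-5, 5-6, 6-7, 7-8.
edge : ℕ → ℕ → Bool
edge 0 2 = true
edge 2 0 = true
edge 1 3 = true
edge 3 1 = true
edge 2 3 = true
edge 3 2 = true
edge 3 4 = true
edge 4 3 = true
edge 4 5 = true
edge 5 4 = true
edge 5 6 = true
edge 6 5 = true
edge 6 7 = true
edge 7 6 = true
edge _ _ = false

cartan : Fin 8 → Fin 8 → ℤ
cartan i j = if does (i ≟ j) then + 2 else (if edge (toℕ i) (toℕ j) then - (+ 1) else + 0)

B : Vec8 → Vec8 → ℤ
B x y = ∑ (λ i → ∑ (λ j → x i * cartan i j * y j))

e : Fin 8 → Vec8
e j i = if does (i ≟ j) then + 1 else + 0

-- reflection in the root β (simply laced, so β^∨ is identified with β)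
reflect : Vec8 → Vec8 → Vec8
reflect β x i = x i - B x β * β i

sr : Fin 8 → Vec8 → Vec8
sr j = reflect (e j)

Map : Set
Map = Vec8 → Vec8

⟦_⟧ : List (Fin 8) → Map
⟦ [] ⟧ x = x
⟦ j ∷ w ⟧ x = sr j (⟦ w ⟧ x)

_≈_ : Map → Map → Set
f ≈ g = ∀ x i → f x i ≡ g x i

_≐_ : Vec8 → Vec8 → Set
x ≐ y = ∀ i → x i ≡ y i

IsRoot : Vec8 → Set
IsRoot β = ∃₂ λ w j → ⟦ w ⟧ (e j) ≐ β

IsPos : Vec8 → Set
IsPos β = ∀ i → + 0 ≤ β i

-- positive roots; these index the reflections T (t ↔ α_t, t = reflect α_t)
PosRoot : Vec8 → Set
PosRoot β = IsRoot β × IsPos β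

HasLength : Map → ℕ → Set
HasLength f n = (∃ λ w → length w ≡ n × ⟦ w ⟧ ≈ f) × (∀ w → ⟦ w ⟧ ≈ f → n ℕ.≤ length w)

Shorter : Map → Map → Set
Shorter f g = ∃₂ λ m n → HasLength f m × HasLength g n × m ℕ.< n

BStep : Map → Map → Set
BStep f g = ∃ λ β → PosRoot β × (g ≈ (f ∘ reflect β)) × Shorter f g

_<ᴮ_ : Map → Map → Set
_<ᴮ_ = TransClosure BStep

D : Map → Vec8 → Set
D w β = PosRoot β × ((w ∘ reflect β) <ᴮ w)

A : Map → Vec8 → Set
A w β = PosRoot β × (w <ᴮ (w ∘ reflect β))

AD : Map → Map → Vec8 → Set
AD u v β = A u β × D v β

_⪯_ : Vec8 → Vec8 → Set
r ⪯ t = ∀ i → + 0 ≤ t i - r i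

MinimalIn : (Vec8 → Set) → Vec8 → Set
MinimalIn P t = P t × (∀ r → P r → r ⪯ t → r ≐ t)

IsSimpleRoot : Vec8 → Set
IsSimpleRoot β = ∃ λ j → β ≐ e j

DR : Map → Fin 8 → Set
DR w j = Shorter (w ∘ sr j) w

-- Everything is computed in the reflection representation of W on ℤ⁸, in the basis of simple
-- roots. Every root is positive or negative, so the strong exchange condition shows that for
-- f ∈ W and a positive root β, ℓ(f t_β) < ℓ(f) exactly when f β is negative: A(f), D(f) and
-- D_R(f) are read off from signs. The only input specific to E8 is a decided table of its 120
-- positive roots, closed under the simple reflections. It yields, for the non-simple minimal
-- β ∈ AD(u, v), a simple root α_j with (β, α_j) = 1. Then γ = s_j β = β − α_j is a positive
-- root, t_β α_j = −γ, and t_β s_j t_β and s_j t_β s_j are both the reflection in γ.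
-- Minimality of β rules out u α_j < 0 < v α_j (γ ≺ β would lie in AD(u, v)) and
-- u α_j > 0 > v α_j (α_j ≺ β would), which is the claim about D_R. Finally δ ↦ s_j δ maps
-- AD(u s_j, v s_j) below γ into AD(u, v) below β, because (δ, α_j) ≥ −1 for positive roots
-- δ ≠ α_j; so γ is minimal.

module Submission where

open import Defs
open import Data.Bool using (true; false; if_then_else_)
open import Data.Empty using (⊥; ⊥-elim)
open import Data.Fin using (Fin; zero; suc; _≟_; _↑ˡ_; #_)
open import Data.Fin.Properties using (all?; any?)
open import Data.Integer using (ℤ; +_; -_; _+_; _-_; _*_; _≤_; _≤?_; +≤+)
import Data.Integer.Properties as ℤ
open import Data.Integer.Tactic.RingSolver using (solve-∀)
open import Data.List using (List; []; _∷_; length; _++_; reverse)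
open import Data.List.Properties using (unfold-reverse)
open import Data.Nat as ℕ using (ℕ; zero; suc)
open import Data.Nat.Induction using (<-wellFounded)
import Data.Nat.Properties as ℕ
open import Data.Product using (_×_; ∃; _,_; proj₁; proj₂; map₂)
open import Data.Sum using (_⊎_; inj₁; inj₂; [_,_]′)
open import Data.Unit using (tt)
open import Data.Vec using (Vec; []; _∷_; lookup)
open import Function using (_∘_)
open import Induction.WellFounded using (Acc; acc)
open import Relation.Binary.Construct.Closure.Transitive using ([_]; _∷_)
open import Relation.Binary.PropositionalEquality
open import Relation.Nullary using (Dec; yes; no; ¬_; does)
open import Relation.Nullary.Decidable using (toWitness; map′; _⊎-dec_)

open ≡-Reasoning

∑-cong : ∀ {n} {f g : Fin n → ℤ} → (∀ i → f i ≡ g i) → ∑ f ≡ ∑ g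
∑-cong {zero}  f≗g = refl
∑-cong {suc n} f≗g = cong₂ _+_ (f≗g zero) (∑-cong (f≗g ∘ suc))

∑-zero : ∀ n → ∑ {n} (λ _ → + 0) ≡ + 0
∑-zero zero    = refl
∑-zero (suc n) = trans (ℤ.+-identityˡ _) (∑-zero n)

∑-distrib-+ : ∀ {n} (f g : Fin n → ℤ) → ∑ (λ i → f i + g i) ≡ ∑ f + ∑ g
∑-distrib-+ {zero}  f g = refl
∑-distrib-+ {suc n} f g = begin
  (f zero + g zero) + ∑ (λ i → f (suc i) + g (suc i))
    ≡⟨ cong (_+_ (f zero + g zero)) (∑-distrib-+ (f ∘ suc) (g ∘ suc)) ⟩
  (f zero + g zero) + (∑ (f ∘ suc) + ∑ (g ∘ suc))
    ≡⟨ interchange (f zero) (g zero) (∑ (f ∘ suc)) (∑ (g ∘ suc)) ⟩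
  (f zero + ∑ (f ∘ suc)) + (g zero + ∑ (g ∘ suc)) ∎
  where
  interchange : ∀ a b c d → (a + b) + (c + d) ≡ (a + c) + (b + d)
  interchange = solve-∀

∑-*ˡ : ∀ {n} a (f : Fin n → ℤ) → ∑ (λ i → a * f i) ≡ a * ∑ f
∑-*ˡ {zero}  a f = sym (ℤ.*-zeroʳ a)
∑-*ˡ {suc n} a f = trans (cong (_+_ (a * f zero)) (∑-*ˡ a (f ∘ suc))) (sym (ℤ.*-distribˡ-+ a _ _))

∑-linear : ∀ {n} a b (f g : Fin n → ℤ) → ∑ (λ i → a * f i + b * g i) ≡ a * ∑ f + b * ∑ g
∑-linear a b f g =
  trans (∑-distrib-+ (λ i → a * f i) (λ i → b * g i)) (cong₂ _+_ (∑-*ˡ a f) (∑-*ˡ b g))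

∑-comm : ∀ {m n} (f : Fin m → Fin n → ℤ) → ∑ (λ i → ∑ (f i)) ≡ ∑ (λ j → ∑ (λ i → f i j))
∑-comm {zero}  {n} f = sym (∑-zero n)
∑-comm {suc m} {n} f = begin
  ∑ (f zero) + ∑ (λ i → ∑ (f (suc i)))
    ≡⟨ cong (_+_ (∑ (f zero))) (∑-comm (f ∘ suc)) ⟩
  ∑ (f zero) + ∑ (λ j → ∑ (λ i → f (suc i) j))
    ≡⟨ sym (∑-distrib-+ (f zero) (λ j → ∑ (λ i → f (suc i) j))) ⟩
  ∑ (λ j → f zero j + ∑ (λ i → f (suc i) j)) ∎

∑-select : ∀ {n} (f : Fin n → ℤ) k → ∑ (λ i → f i * (if does (i ≟ k) then + 1 else + 0)) ≡ f k
∑-select {suc n} f zero = begin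
  f zero * + 1 + ∑ (λ i → f (suc i) * + 0)
    ≡⟨ cong₂ _+_ (ℤ.*-identityʳ (f zero)) (trans (∑-cong (ℤ.*-zeroʳ ∘ f ∘ suc)) (∑-zero n)) ⟩
  f zero + + 0
    ≡⟨ ℤ.+-identityʳ (f zero) ⟩
  f zero ∎
∑-select {suc n} f (suc k) =
  trans (cong₂ _+_ (ℤ.*-zeroʳ (f zero)) (∑-select (f ∘ suc) k)) (ℤ.+-identityˡ (f (suc k)))

-- The form B and reflections

cartan-sym : ∀ i j → cartan i j ≡ cartan j i
cartan-sym = toWitness {a? = all? λ i → all? λ j → cartan i j ℤ.≟ cartan j i} tt

e-sym : ∀ i j → e i j ≡ e j i
e-sym = toWitness {a? = all? λ i → all? λ j → e i j ℤ.≟ e j i} tt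

e-diag : ∀ j → e j j ≡ + 1
e-diag = toWitness {a? = all? λ j → e j j ℤ.≟ + 1} tt

e-IsPos : ∀ j → IsPos (e j)
e-IsPos j i with does (i ≟ j)
... | true  = +≤+ ℕ.z≤n
... | false = +≤+ ℕ.z≤n

e-PosRoot : ∀ j → PosRoot (e j)
e-PosRoot j = ([] , j , λ _ → refl) , e-IsPos j

B-eₖ-eₖ : ∀ k → B (e k) (e k) ≡ + 2
B-eₖ-eₖ = toWitness {a? = all? λ k → B (e k) (e k) ℤ.≟ + 2} tt

comb : ℤ → Vec8 → ℤ → Vec8 → Vec8
comb a x b y i = a * x i + b * y i

neg : Vec8 → Vec8
neg x i = - x i

infixl 25 _⊖_
_⊖_ : Vec8 → Vec8 → Vec8
(x ⊖ y) i = x i - y i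

≐-sym : ∀ {x y} → x ≐ y → y ≐ x
≐-sym x≐y i = sym (x≐y i)

≐-trans : ∀ {x y z} → x ≐ y → y ≐ z → x ≐ z
≐-trans x≐y y≐z i = trans (x≐y i) (y≐z i)

expand : ∀ x → x ≐ (λ i → ∑ (λ j → x j * e j i))
expand x i = sym (trans (∑-cong (λ j → cong (x j *_) (e-sym j i))) (∑-select x i))

B-cong : ∀ {x x' y y'} → x ≐ x' → y ≐ y' → B x y ≡ B x' y'
B-cong x≐x' y≐y' = ∑-cong λ i → ∑-cong λ j → cong₂ (λ p q → p * cartan i j * q) (x≐x' i) (y≐y' j)

B-congˡ : ∀ {x x'} y → x ≐ x' → B x y ≡ B x' y
B-congˡ y x≐x' = B-cong {y = y} {y' = y} x≐x' λ _ → refl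

B-congʳ : ∀ x {y y'} → y ≐ y' → B x y ≡ B x y'
B-congʳ x y≐y' = B-cong {x = x} {x' = x} (λ _ → refl) y≐y'

B-sym : ∀ x y → B x y ≡ B y x
B-sym x y = trans (∑-comm (λ i j → x i * cartan i j * y j))
                  (∑-cong λ j → ∑-cong λ i → trans (cong (λ c → x i * c * y j) (cartan-sym i j)) (swap (x i) (cartan j i) (y j)))
  where
  swap : ∀ p c q → p * c * q ≡ q * c * p
  swap = solve-∀

B-combˡ : ∀ a x b y z → B (comb a x b y) z ≡ a * B x z + b * B y z
B-combˡ a x b y z = begin
  ∑ (λ i → ∑ (λ j → (a * x i + b * y i) * cartan i j * z j))
    ≡⟨ ∑-cong (λ i → trans (∑-cong (λ j → distrib a b (x i) (y i) (cartan i j) (z j)))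
                           (∑-linear a b (λ j → x i * cartan i j * z j) (λ j → y i * cartan i j * z j))) ⟩
  ∑ (λ i → a * ∑ (λ j → x i * cartan i j * z j) + b * ∑ (λ j → y i * cartan i j * z j))
    ≡⟨ ∑-linear a b (λ i → ∑ (λ j → x i * cartan i j * z j)) (λ i → ∑ (λ j → y i * cartan i j * z j)) ⟩
  a * B x z + b * B y z ∎
  where
  distrib : ∀ a b p q c r → (a * p + b * q) * c * r ≡ a * (p * c * r) + b * (q * c * r)
  distrib = solve-∀

B-combʳ : ∀ z a x b y → B z (comb a x b y) ≡ a * B z x + b * B z y
B-combʳ z a x b y =
  trans (B-sym z (comb a x b y)) (trans (B-combˡ a x b y z) (cong₂ (λ p q → a * p + b * q) (B-sym x z) (B-sym y z)))

B-e : ∀ x k → B x (e k) ≡ ∑ (λ i → x i * cartan i k)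
B-e x k = ∑-cong (λ i → ∑-select (λ j → x i * cartan i j) k)

reflect-cong : ∀ {α α' x x'} → α ≐ α' → x ≐ x' → reflect α x ≐ reflect α' x'
reflect-cong α≐α' x≐x' i = cong₂ _-_ (x≐x' i) (cong₂ _*_ (B-cong x≐x' α≐α') (α≐α' i))

reflect-congˡ : ∀ {α α'} → α ≐ α' → ∀ x → reflect α x ≐ reflect α' x
reflect-congˡ α≐α' x = reflect-cong {x = x} α≐α' (λ _ → refl)

reflect-congʳ : ∀ α {x x'} → x ≐ x' → reflect α x ≐ reflect α x'
reflect-congʳ α = reflect-cong {α} (λ _ → refl)

reflect-as-comb : ∀ α x → reflect α x ≐ comb (+ 1) x (- B x α) α
reflect-as-comb α x i = rearrange (x i) (B x α) (α i)
  where
  rearrange : ∀ p c q → p - c * q ≡ + 1 * p + - c * q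
  rearrange = solve-∀

B-reflectˡ : ∀ α x z → B (reflect α x) z ≡ B x z - B x α * B α z
B-reflectˡ α x z = begin
  B (reflect α x) z                              ≡⟨ B-congˡ z (reflect-as-comb α x) ⟩
  B (comb (+ 1) x (- B x α) α) z                 ≡⟨ B-combˡ (+ 1) x (- B x α) α z ⟩
  + 1 * B x z + - B x α * B α z                  ≡⟨ rearrange (B x z) (B x α) (B α z) ⟩
  B x z - B x α * B α z                          ∎
  where
  rearrange : ∀ p c q → + 1 * p + - c * q ≡ p - c * q
  rearrange = solve-∀

reflect-involutive : ∀ α x → B α α ≡ + 2 → reflect α (reflect α x) ≐ x
reflect-involutive α x ‖α‖²≡2 i = begin
  (x i - B x α * α i) - B (reflect α x) α * α i
    ≡⟨ cong (λ c → (x i - B x α * α i) - c * α i) (trans (B-reflectˡ α x α) (cong (λ d → B x α - B x α * d) ‖α‖²≡2)) ⟩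
  (x i - B x α * α i) - (B x α - B x α * + 2) * α i
    ≡⟨ cancel (x i) (B x α) (α i) ⟩
  x i ∎
  where
  cancel : ∀ p c q → (p - c * q) - (c - c * + 2) * q ≡ p
  cancel = solve-∀

reflect-isometry : ∀ α x y → B α α ≡ + 2 → B (reflect α x) (reflect α y) ≡ B x y
reflect-isometry α x y ‖α‖²≡2 = begin
  B (reflect α x) (reflect α y)
    ≡⟨ B-reflectˡ α x (reflect α y) ⟩
  B x (reflect α y) - B x α * B α (reflect α y)
    ≡⟨ cong₂ (λ p q → p - B x α * q)
         (trans (B-sym x (reflect α y)) (trans (B-reflectˡ α y x) (cong (λ d → B y x - B y α * d) (B-sym α x))))
         (trans (B-sym α (reflect α y)) (trans (B-reflectˡ α y α) (cong (λ d → B y α - B y α * d) ‖α‖²≡2))) ⟩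
  (B y x - B y α * B x α) - B x α * (B y α - B y α * + 2)
    ≡⟨ cancel (B y x) (B y α) (B x α) ⟩
  B y x
    ≡⟨ B-sym y x ⟩
  B x y ∎
  where
  cancel : ∀ p a b → (p - a * b) - b * (a - a * + 2) ≡ p
  cancel = solve-∀

reflect-comb : ∀ α a x b y → reflect α (comb a x b y) ≐ comb a (reflect α x) b (reflect α y)
reflect-comb α a x b y i =
  trans (cong (λ c → (a * x i + b * y i) - c * α i) (B-combˡ a x b y α))
        (distrib a (x i) b (y i) (B x α) (B y α) (α i))
  where
  distrib : ∀ a p b q c d r → (a * p + b * q) - (a * c + b * d) * r ≡ a * (p - c * r) + b * (q - d * r)
  distrib = solve-∀

reflect-conj : ∀ α β x → B α α ≡ + 2 → reflect α (reflect β x) ≐ reflect (reflect α β) (reflect α x)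
reflect-conj α β x ‖α‖²≡2 i = begin
  reflect α (reflect β x) i
    ≡⟨ reflect-congʳ α (reflect-as-comb β x) i ⟩
  reflect α (comb (+ 1) x (- B x β) β) i
    ≡⟨ reflect-comb α (+ 1) x (- B x β) β i ⟩
  + 1 * reflect α x i + - B x β * reflect α β i
    ≡⟨ cong (λ c → + 1 * reflect α x i + - c * reflect α β i) (sym (reflect-isometry α x β ‖α‖²≡2)) ⟩
  + 1 * reflect α x i + - B (reflect α x) (reflect α β) * reflect α β i
    ≡⟨ sym (reflect-as-comb (reflect α β) (reflect α x) i) ⟩
  reflect (reflect α β) (reflect α x) i ∎

reflect-self : ∀ α → B α α ≡ + 2 → reflect α α ≐ neg α
reflect-self α ‖α‖²≡2 i = trans (cong (λ c → α i - c * α i) ‖α‖²≡2) (double (α i))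
  where
  double : ∀ p → p - + 2 * p ≡ - p
  double = solve-∀

reflect-neg : ∀ α x → reflect (neg α) x ≐ reflect α x
reflect-neg α x i = cong (λ c → x i - c) (begin
  B x (neg α) * - α i
    ≡⟨ cong (_* - α i) (trans (B-congʳ x {neg α} (λ j → as-comb (α j))) (B-combʳ x (- + 1) α (+ 0) α)) ⟩
  (- + 1 * B x α + + 0 * B x α) * - α i
    ≡⟨ simplify (B x α) (α i) ⟩
  B x α * α i ∎)
  where
  as-comb : ∀ p → - p ≡ - + 1 * p + + 0 * p
  as-comb = solve-∀
  simplify : ∀ c q → (- + 1 * c + + 0 * c) * - q ≡ c * q
  simplify = solve-∀

reflect-B≡1 : ∀ α x → B x α ≡ + 1 → reflect α x ≐ x ⊖ α
reflect-B≡1 α x Bxα≡1 i = cong (λ c → x i - c) (trans (cong (_* α i) Bxα≡1) (ℤ.*-identityˡ (α i)))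

reflect-swap : ∀ α x → B x α ≡ + 1 → reflect α x ≐ neg (reflect x α)
reflect-swap α x Bxα≡1 i = begin
  reflect α x i         ≡⟨ reflect-B≡1 α x Bxα≡1 i ⟩
  x i - α i             ≡⟨ antisymmetry (x i) (α i) ⟩
  - (α i - x i)         ≡⟨ cong -_ (reflect-B≡1 x α (trans (B-sym α x) Bxα≡1) i) ⟨
  - reflect x α i       ∎
  where
  antisymmetry : ∀ p q → p - q ≡ - (q - p)
  antisymmetry = solve-∀

reflect-conjugate : ∀ α β → B α α ≡ + 2 → (reflect α ∘ reflect β ∘ reflect α) ≈ reflect (reflect α β)
reflect-conjugate α β ‖α‖²≡2 x =
  ≐-trans (reflect-conj α β (reflect α x) ‖α‖²≡2) (reflect-congʳ (reflect α β) (reflect-involutive α x ‖α‖²≡2))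

≈-refl : ∀ {f} → f ≈ f
≈-refl x i = refl

≈-sym : ∀ {f g} → f ≈ g → g ≈ f
≈-sym f≈g x i = sym (f≈g x i)

≈-trans : ∀ {f g h} → f ≈ g → g ≈ h → f ≈ h
≈-trans f≈g g≈h x i = trans (f≈g x i) (g≈h x i)

record IsLinear (f : Map) : Set where
  field
    preserves-≐    : ∀ {x y} → x ≐ y → f x ≐ f y
    preserves-comb : ∀ a x b y → f (comb a x b y) ≐ comb a (f x) b (f y)

  preserves-neg : ∀ x → f (neg x) ≐ neg (f x)
  preserves-neg x i = begin
    f (neg x) i                        ≡⟨ preserves-≐ {neg x} (λ j → as-comb (x j)) i ⟩
    f (comb (- + 1) x (+ 0) x) i       ≡⟨ preserves-comb (- + 1) x (+ 0) x i ⟩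
    - + 1 * f x i + + 0 * f x i        ≡⟨ simplify (f x i) ⟩
    - f x i                            ∎
    where
    as-comb : ∀ p → - p ≡ - + 1 * p + + 0 * p
    as-comb = solve-∀
    simplify : ∀ p → - + 1 * p + + 0 * p ≡ - p
    simplify = solve-∀

  preserves-⊖ : ∀ x y → f (x ⊖ y) ≐ f x ⊖ f y
  preserves-⊖ x y i = begin
    f (x ⊖ y) i                        ≡⟨ preserves-≐ {x ⊖ y} (λ j → as-comb (x j) (y j)) i ⟩
    f (comb (+ 1) x (- + 1) y) i       ≡⟨ preserves-comb (+ 1) x (- + 1) y i ⟩
    + 1 * f x i + - + 1 * f y i        ≡⟨ simplify (f x i) (f y i) ⟩
    f x i - f y i                      ∎
    where
    as-comb : ∀ p q → p - q ≡ + 1 * p + - + 1 * q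
    as-comb = solve-∀
    simplify : ∀ p q → + 1 * p + - + 1 * q ≡ p - q
    simplify = solve-∀

  preserves-∑ : ∀ {n} (c : Fin n → ℤ) (v : Fin n → Vec8) →
                f (λ i → ∑ (λ j → c j * v j i)) ≐ (λ i → ∑ (λ j → c j * f (v j) i))
  preserves-∑ {zero} c v i = begin
    f o i                              ≡⟨ preserves-comb (+ 0) o (+ 0) o i ⟩
    + 0 * f o i + + 0 * f o i          ≡⟨ vanish (f o i) ⟩
    + 0                                ∎
    where
    o : Vec8
    o _ = + 0
    vanish : ∀ p → + 0 * p + + 0 * p ≡ + 0
    vanish = solve-∀
  preserves-∑ {suc n} c v i = begin
    f (λ i → c zero * v zero i + rest i) i
      ≡⟨ preserves-≐ {λ i → c zero * v zero i + rest i} (λ j → cong (_+_ (c zero * v zero j)) (sym (ℤ.*-identityˡ (rest j)))) i ⟩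
    f (comb (c zero) (v zero) (+ 1) rest) i
      ≡⟨ preserves-comb (c zero) (v zero) (+ 1) rest i ⟩
    c zero * f (v zero) i + + 1 * f rest i
      ≡⟨ cong (_+_ (c zero * f (v zero) i)) (trans (ℤ.*-identityˡ (f rest i)) (preserves-∑ (c ∘ suc) (v ∘ suc) i)) ⟩
    c zero * f (v zero) i + ∑ (λ j → c (suc j) * f (v (suc j)) i) ∎
    where
    rest : Vec8
    rest i = ∑ (λ j → c (suc j) * v (suc j) i)

  decompose : ∀ x i → f x i ≡ ∑ (λ j → x j * f (e j) i)
  decompose x i = trans (preserves-≐ (expand x) i) (preserves-∑ x e i)

open IsLinear

id-isLinear : IsLinear (λ x → x)
id-isLinear = record { preserves-≐ = λ x≐y → x≐y ; preserves-comb = λ _ _ _ _ _ → refl }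

∘-isLinear : ∀ {f g} → IsLinear f → IsLinear g → IsLinear (f ∘ g)
∘-isLinear {f} {g} F G = record
  { preserves-≐    = preserves-≐ F ∘ preserves-≐ G
  ; preserves-comb = λ a x b y → ≐-trans (preserves-≐ F (preserves-comb G a x b y)) (preserves-comb F a (g x) b (g y))
  }

≈-isLinear : ∀ {f g} → f ≈ g → IsLinear f → IsLinear g
≈-isLinear {f} {g} f≈g F = record
  { preserves-≐    = λ {x} {y} x≐y i → trans (sym (f≈g x i)) (trans (preserves-≐ F x≐y i) (f≈g y i))
  ; preserves-comb = λ a x b y i → trans (sym (f≈g (comb a x b y) i))
                                         (trans (preserves-comb F a x b y i) (cong₂ (λ p q → a * p + b * q) (f≈g x i) (f≈g y i)))
  }

reflect-isLinear : ∀ α → IsLinear (reflect α)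
reflect-isLinear α = record { preserves-≐ = reflect-congʳ α ; preserves-comb = reflect-comb α }

Word : Set
Word = List (Fin 8)

⟦⟧-isLinear : ∀ w → IsLinear ⟦ w ⟧
⟦⟧-isLinear []      = id-isLinear
⟦⟧-isLinear (k ∷ w) = ∘-isLinear (reflect-isLinear (e k)) (⟦⟧-isLinear w)

⟦⟧-++ : ∀ w w' x → ⟦ w ++ w' ⟧ x ≐ ⟦ w ⟧ (⟦ w' ⟧ x)
⟦⟧-++ []      w' x i = refl
⟦⟧-++ (k ∷ w) w' x   = reflect-congʳ (e k) (⟦⟧-++ w w' x)

⟦⟧-isometry : ∀ w x y → B (⟦ w ⟧ x) (⟦ w ⟧ y) ≡ B x y
⟦⟧-isometry []      x y = refl
⟦⟧-isometry (k ∷ w) x y = trans (reflect-isometry (e k) (⟦ w ⟧ x) (⟦ w ⟧ y) (B-eₖ-eₖ k)) (⟦⟧-isometry w x y)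

⟦⟧-conj : ∀ w β x → ⟦ w ⟧ (reflect β x) ≐ reflect (⟦ w ⟧ β) (⟦ w ⟧ x)
⟦⟧-conj []      β x i = refl
⟦⟧-conj (k ∷ w) β x   =
  ≐-trans (reflect-congʳ (e k) (⟦⟧-conj w β x)) (reflect-conj (e k) (⟦ w ⟧ β) (⟦ w ⟧ x) (B-eₖ-eₖ k))

⟦⟧-reverse : ∀ w x → ⟦ w ⟧ (⟦ reverse w ⟧ x) ≐ x
⟦⟧-reverse []      x i = refl
⟦⟧-reverse (k ∷ w) x rewrite unfold-reverse k w =
  ≐-trans (reflect-congʳ (e k) (≐-trans (preserves-≐ (⟦⟧-isLinear w) (⟦⟧-++ (reverse w) (k ∷ []) x)) (⟦⟧-reverse w (sr k x))))
          (reflect-involutive (e k) x (B-eₖ-eₖ k))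

_≈?_ : ∀ w w' → Dec (⟦ w ⟧ ≈ ⟦ w' ⟧)
w ≈? w' = map′ agree⇒≈ (λ w≈w' j i → w≈w' (e j) i) (all? λ j → all? λ i → ⟦ w ⟧ (e j) i ℤ.≟ ⟦ w' ⟧ (e j) i)
  where
  agree⇒≈ : (∀ j i → ⟦ w ⟧ (e j) i ≡ ⟦ w' ⟧ (e j) i) → ⟦ w ⟧ ≈ ⟦ w' ⟧
  agree⇒≈ agree x i = begin
    ⟦ w ⟧ x i                          ≡⟨ decompose (⟦⟧-isLinear w) x i ⟩
    ∑ (λ j → x j * ⟦ w ⟧ (e j) i)      ≡⟨ ∑-cong (λ j → cong (x j *_) (agree j i)) ⟩
    ∑ (λ j → x j * ⟦ w' ⟧ (e j) i)     ≡⟨ decompose (⟦⟧-isLinear w') x i ⟨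
    ⟦ w' ⟧ x i                         ∎

module _ {P : ℕ → Set} (P? : ∀ n → Dec (P n)) where

  least-witness : ∀ {n} → P n → ∃ λ m → P m × (∀ k → P k → m ℕ.≤ k)
  least-witness {n} = go n (<-wellFounded n)
    where
    go : ∀ n → Acc ℕ._<_ n → P n → ∃ λ m → P m × (∀ k → P k → m ℕ.≤ k)
    go n (acc smaller) pn with ℕ.anyUpTo? P? n
    ... | yes (m , m<n , pm) = go m (smaller m<n) pm
    ... | no ∄smaller        = n , pn , λ k pk → ℕ.≮⇒≥ (λ k<n → ∄smaller (k , k<n , pk))

any-word-of-length? : ∀ {P : Word → Set} → (∀ w → Dec (P w)) → ∀ n → Dec (∃ λ w → length w ≡ n × P w)
any-word-of-length? P? zero    = map′ (λ p → [] , refl , p) (λ { ([] , _ , p) → p }) (P? [])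
any-word-of-length? P? (suc n) =
  map′ (λ { (k , w , |w|≡n , p) → k ∷ w , cong suc |w|≡n , p })
       (λ { (k ∷ w , |w|≡1+n , p) → k , w , ℕ.suc-injective |w|≡1+n , p })
       (any? λ k → any-word-of-length? (λ w → P? (k ∷ w)) n)

length-exists : ∀ w → ∃ (HasLength ⟦ w ⟧)
length-exists w with least-witness (any-word-of-length? (_≈? w)) (w , refl , ≈-refl)
... | m , shortest , minimal = m , shortest , λ w' w'≈w → minimal (length w') (w' , refl , w'≈w)

HasLength-resp-≈ : ∀ {f g n} → f ≈ g → HasLength f n → HasLength g n
HasLength-resp-≈ f≈g ((w , |w|≡n , w≈f) , minimal) =
  (w , |w|≡n , ≈-trans w≈f f≈g) , λ w' w'≈g → minimal w' (≈-trans w'≈g (≈-sym f≈g))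

HasLength-unique : ∀ {f m n} → HasLength f m → HasLength f n → m ≡ n
HasLength-unique ((w , |w|≡m , w≈f) , m-minimal) ((w' , |w'|≡n , w'≈f) , n-minimal) =
  ℕ.≤-antisym (subst (_ ℕ.≤_) |w'|≡n (m-minimal w' w'≈f)) (subst (_ ℕ.≤_) |w|≡m (n-minimal w w≈f))

Shorter-resp-≈ : ∀ {f g f' g'} → f ≈ f' → g ≈ g' → Shorter f g → Shorter f' g'
Shorter-resp-≈ f≈f' g≈g' (m , n , ℓf , ℓg , m<n) = m , n , HasLength-resp-≈ f≈f' ℓf , HasLength-resp-≈ g≈g' ℓg , m<n

Shorter-trans : ∀ {f g h} → Shorter f g → Shorter g h → Shorter f h
Shorter-trans (l , m , ℓf , ℓg , l<m) (m' , n , ℓg' , ℓh , m'<n) =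
  l , n , ℓf , ℓh , ℕ.<-trans l<m (subst (ℕ._< n) (HasLength-unique ℓg' ℓg) m'<n)

Shorter-asym : ∀ {f g} → Shorter f g → ¬ Shorter g f
Shorter-asym (m , n , ℓf , ℓg , m<n) (n' , m' , ℓg' , ℓf' , n'<m') =
  ℕ.<-asym m<n (subst₂ ℕ._<_ (HasLength-unique ℓg' ℓg) (HasLength-unique ℓf' ℓf) n'<m')

InW : Map → Set
InW f = ∃ λ w → ⟦ w ⟧ ≈ f

InW-length : ∀ {f} → InW f → ∃ (HasLength f)
InW-length (w , w≈f) with length-exists w
... | n , ℓw = n , HasLength-resp-≈ w≈f ℓw

InW-isLinear : ∀ {f} → InW f → IsLinear f
InW-isLinear (w , w≈f) = ≈-isLinear w≈f (⟦⟧-isLinear w)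

InW-∘ : ∀ {f g} → InW f → InW g → InW (f ∘ g)
InW-∘ {f} {g} (w , w≈f) (w' , w'≈g) = w ++ w' , λ x →
  ≐-trans (⟦⟧-++ w w' x) (≐-trans (preserves-≐ (⟦⟧-isLinear w) (w'≈g x)) (w≈f (g x)))

sr-InW : ∀ j → InW (sr j)
sr-InW j = j ∷ [] , ≈-refl

reflect-InW : ∀ {β} → IsRoot β → InW (reflect β)
reflect-InW {β} (w , j , wαⱼ≐β) = w ++ j ∷ reverse w , λ x i → begin
  ⟦ w ++ j ∷ reverse w ⟧ x i                        ≡⟨ ⟦⟧-++ w (j ∷ reverse w) x i ⟩
  ⟦ w ⟧ (sr j (⟦ reverse w ⟧ x)) i                  ≡⟨ ⟦⟧-conj w (e j) (⟦ reverse w ⟧ x) i ⟩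
  reflect (⟦ w ⟧ (e j)) (⟦ w ⟧ (⟦ reverse w ⟧ x)) i  ≡⟨ reflect-cong wαⱼ≐β (⟦⟧-reverse w x) i ⟩
  reflect β x i                                     ∎

InW-IsRoot : ∀ {f β} → InW f → IsRoot β → IsRoot (f β)
InW-IsRoot {f} {β} (w , w≈f) (w' , j , w'αⱼ≐β) =
  w ++ w' , j , ≐-trans (⟦⟧-++ w w' (e j)) (≐-trans (preserves-≐ (⟦⟧-isLinear w) w'αⱼ≐β) (w≈f β))

B-root : ∀ {β} → IsRoot β → B β β ≡ + 2
B-root (w , j , wαⱼ≐β) = trans (B-cong (≐-sym wαⱼ≐β) (≐-sym wαⱼ≐β)) (trans (⟦⟧-isometry w (e j) (e j)) (B-eₖ-eₖ j))

IsNeg : Vec8 → Set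
IsNeg x = ∀ i → x i ≤ + 0

IsPos-resp : ∀ {x y} → x ≐ y → IsPos x → IsPos y
IsPos-resp x≐y x≥0 i = subst (+ 0 ≤_) (x≐y i) (x≥0 i)

IsNeg-resp : ∀ {x y} → x ≐ y → IsNeg x → IsNeg y
IsNeg-resp x≐y x≤0 i = subst (_≤ + 0) (x≐y i) (x≤0 i)

neg-IsPos : ∀ {x} → IsPos x → IsNeg (neg x)
neg-IsPos x≥0 i = ℤ.neg-mono-≤ (x≥0 i)

neg-IsNeg : ∀ {x} → IsNeg x → IsPos (neg x)
neg-IsNeg x≤0 i = ℤ.neg-mono-≤ (x≤0 i)

neg-involutive : ∀ x → neg (neg x) ≐ x
neg-involutive x i = ℤ.neg-involutive (x i)

⊖-IsPos : ∀ {x y} → IsPos x → IsNeg y → IsPos (x ⊖ y)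
⊖-IsPos x≥0 y≤0 i = ℤ.+-mono-≤ (x≥0 i) (ℤ.neg-mono-≤ (y≤0 i))

⊖-IsNeg : ∀ {x y} → IsNeg x → IsPos y → IsNeg (x ⊖ y)
⊖-IsNeg x≤0 y≥0 i = ℤ.+-mono-≤ (x≤0 i) (ℤ.neg-mono-≤ (y≥0 i))

*-nonNeg : ∀ {a b} → + 0 ≤ a → + 0 ≤ b → + 0 ≤ a * b
*-nonNeg {+ m} {+ n} _ _ = subst (+ 0 ≤_) (ℤ.pos-* m n) (+≤+ ℕ.z≤n)

-- The positive roots of E8

-- B x (e k) as a single sum (B-e); deciding the table facts through B itself is much slower.
Bₑ : Vec8 → Fin 8 → ℤ
Bₑ x k = ∑ (λ i → x i * cartan i k)

srₑ : Fin 8 → Vec8 → Vec8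
srₑ k x i = x i - Bₑ x k * e k i

srₑ≐sr : ∀ k x → srₑ k x ≐ sr k x
srₑ≐sr k x i = cong (λ c → x i - c * e k i) (sym (B-e x k))

_≐?_ : ∀ x y → Dec (x ≐ y)
x ≐? y = all? λ i → x i ℤ.≟ y i

-- Abstract, so that the tables are unfolded only by the decided facts below.
abstract
  positiveRoots : Vec (Vec ℕ 8) 120
  positiveRoots =
    (1 ∷ 0 ∷ 0 ∷ 0 ∷ 0 ∷ 0 ∷ 0 ∷ 0 ∷ []) ∷
    (0 ∷ 1 ∷ 0 ∷ 0 ∷ 0 ∷ 0 ∷ 0 ∷ 0 ∷ []) ∷
    (0 ∷ 0 ∷ 1 ∷ 0 ∷ 0 ∷ 0 ∷ 0 ∷ 0 ∷ []) ∷
    (0 ∷ 0 ∷ 0 ∷ 1 ∷ 0 ∷ 0 ∷ 0 ∷ 0 ∷ []) ∷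
    (0 ∷ 0 ∷ 0 ∷ 0 ∷ 1 ∷ 0 ∷ 0 ∷ 0 ∷ []) ∷
    (0 ∷ 0 ∷ 0 ∷ 0 ∷ 0 ∷ 1 ∷ 0 ∷ 0 ∷ []) ∷
    (0 ∷ 0 ∷ 0 ∷ 0 ∷ 0 ∷ 0 ∷ 1 ∷ 0 ∷ []) ∷
    (0 ∷ 0 ∷ 0 ∷ 0 ∷ 0 ∷ 0 ∷ 0 ∷ 1 ∷ []) ∷
    (0 ∷ 0 ∷ 0 ∷ 0 ∷ 0 ∷ 0 ∷ 1 ∷ 1 ∷ []) ∷
    (0 ∷ 0 ∷ 0 ∷ 0 ∷ 0 ∷ 1 ∷ 1 ∷ 0 ∷ []) ∷
    (0 ∷ 0 ∷ 0 ∷ 0 ∷ 1 ∷ 1 ∷ 0 ∷ 0 ∷ []) ∷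
    (0 ∷ 0 ∷ 0 ∷ 1 ∷ 1 ∷ 0 ∷ 0 ∷ 0 ∷ []) ∷
    (0 ∷ 0 ∷ 1 ∷ 1 ∷ 0 ∷ 0 ∷ 0 ∷ 0 ∷ []) ∷
    (0 ∷ 1 ∷ 0 ∷ 1 ∷ 0 ∷ 0 ∷ 0 ∷ 0 ∷ []) ∷
    (1 ∷ 0 ∷ 1 ∷ 0 ∷ 0 ∷ 0 ∷ 0 ∷ 0 ∷ []) ∷
    (0 ∷ 0 ∷ 0 ∷ 0 ∷ 0 ∷ 1 ∷ 1 ∷ 1 ∷ []) ∷
    (0 ∷ 0 ∷ 0 ∷ 0 ∷ 1 ∷ 1 ∷ 1 ∷ 0 ∷ []) ∷
    (0 ∷ 0 ∷ 0 ∷ 1 ∷ 1 ∷ 1 ∷ 0 ∷ 0 ∷ []) ∷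
    (0 ∷ 0 ∷ 1 ∷ 1 ∷ 1 ∷ 0 ∷ 0 ∷ 0 ∷ []) ∷
    (0 ∷ 1 ∷ 0 ∷ 1 ∷ 1 ∷ 0 ∷ 0 ∷ 0 ∷ []) ∷
    (0 ∷ 1 ∷ 1 ∷ 1 ∷ 0 ∷ 0 ∷ 0 ∷ 0 ∷ []) ∷
    (1 ∷ 0 ∷ 1 ∷ 1 ∷ 0 ∷ 0 ∷ 0 ∷ 0 ∷ []) ∷
    (0 ∷ 0 ∷ 0 ∷ 0 ∷ 1 ∷ 1 ∷ 1 ∷ 1 ∷ []) ∷
    (0 ∷ 0 ∷ 0 ∷ 1 ∷ 1 ∷ 1 ∷ 1 ∷ 0 ∷ []) ∷
    (0 ∷ 0 ∷ 1 ∷ 1 ∷ 1 ∷ 1 ∷ 0 ∷ 0 ∷ []) ∷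
    (0 ∷ 1 ∷ 0 ∷ 1 ∷ 1 ∷ 1 ∷ 0 ∷ 0 ∷ []) ∷
    (0 ∷ 1 ∷ 1 ∷ 1 ∷ 1 ∷ 0 ∷ 0 ∷ 0 ∷ []) ∷
    (1 ∷ 0 ∷ 1 ∷ 1 ∷ 1 ∷ 0 ∷ 0 ∷ 0 ∷ []) ∷
    (1 ∷ 1 ∷ 1 ∷ 1 ∷ 0 ∷ 0 ∷ 0 ∷ 0 ∷ []) ∷
    (0 ∷ 0 ∷ 0 ∷ 1 ∷ 1 ∷ 1 ∷ 1 ∷ 1 ∷ []) ∷
    (0 ∷ 0 ∷ 1 ∷ 1 ∷ 1 ∷ 1 ∷ 1 ∷ 0 ∷ []) ∷
    (0 ∷ 1 ∷ 0 ∷ 1 ∷ 1 ∷ 1 ∷ 1 ∷ 0 ∷ []) ∷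
    (0 ∷ 1 ∷ 1 ∷ 1 ∷ 1 ∷ 1 ∷ 0 ∷ 0 ∷ []) ∷
    (0 ∷ 1 ∷ 1 ∷ 2 ∷ 1 ∷ 0 ∷ 0 ∷ 0 ∷ []) ∷
    (1 ∷ 0 ∷ 1 ∷ 1 ∷ 1 ∷ 1 ∷ 0 ∷ 0 ∷ []) ∷
    (1 ∷ 1 ∷ 1 ∷ 1 ∷ 1 ∷ 0 ∷ 0 ∷ 0 ∷ []) ∷
    (0 ∷ 0 ∷ 1 ∷ 1 ∷ 1 ∷ 1 ∷ 1 ∷ 1 ∷ []) ∷
    (0 ∷ 1 ∷ 0 ∷ 1 ∷ 1 ∷ 1 ∷ 1 ∷ 1 ∷ []) ∷
    (0 ∷ 1 ∷ 1 ∷ 1 ∷ 1 ∷ 1 ∷ 1 ∷ 0 ∷ []) ∷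
    (0 ∷ 1 ∷ 1 ∷ 2 ∷ 1 ∷ 1 ∷ 0 ∷ 0 ∷ []) ∷
    (1 ∷ 0 ∷ 1 ∷ 1 ∷ 1 ∷ 1 ∷ 1 ∷ 0 ∷ []) ∷
    (1 ∷ 1 ∷ 1 ∷ 1 ∷ 1 ∷ 1 ∷ 0 ∷ 0 ∷ []) ∷
    (1 ∷ 1 ∷ 1 ∷ 2 ∷ 1 ∷ 0 ∷ 0 ∷ 0 ∷ []) ∷
    (0 ∷ 1 ∷ 1 ∷ 1 ∷ 1 ∷ 1 ∷ 1 ∷ 1 ∷ []) ∷
    (0 ∷ 1 ∷ 1 ∷ 2 ∷ 1 ∷ 1 ∷ 1 ∷ 0 ∷ []) ∷
    (0 ∷ 1 ∷ 1 ∷ 2 ∷ 2 ∷ 1 ∷ 0 ∷ 0 ∷ []) ∷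
    (1 ∷ 0 ∷ 1 ∷ 1 ∷ 1 ∷ 1 ∷ 1 ∷ 1 ∷ []) ∷
    (1 ∷ 1 ∷ 1 ∷ 1 ∷ 1 ∷ 1 ∷ 1 ∷ 0 ∷ []) ∷
    (1 ∷ 1 ∷ 1 ∷ 2 ∷ 1 ∷ 1 ∷ 0 ∷ 0 ∷ []) ∷
    (1 ∷ 1 ∷ 2 ∷ 2 ∷ 1 ∷ 0 ∷ 0 ∷ 0 ∷ []) ∷
    (0 ∷ 1 ∷ 1 ∷ 2 ∷ 1 ∷ 1 ∷ 1 ∷ 1 ∷ []) ∷
    (0 ∷ 1 ∷ 1 ∷ 2 ∷ 2 ∷ 1 ∷ 1 ∷ 0 ∷ []) ∷
    (1 ∷ 1 ∷ 1 ∷ 1 ∷ 1 ∷ 1 ∷ 1 ∷ 1 ∷ []) ∷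
    (1 ∷ 1 ∷ 1 ∷ 2 ∷ 1 ∷ 1 ∷ 1 ∷ 0 ∷ []) ∷
    (1 ∷ 1 ∷ 1 ∷ 2 ∷ 2 ∷ 1 ∷ 0 ∷ 0 ∷ []) ∷
    (1 ∷ 1 ∷ 2 ∷ 2 ∷ 1 ∷ 1 ∷ 0 ∷ 0 ∷ []) ∷
    (0 ∷ 1 ∷ 1 ∷ 2 ∷ 2 ∷ 1 ∷ 1 ∷ 1 ∷ []) ∷
    (0 ∷ 1 ∷ 1 ∷ 2 ∷ 2 ∷ 2 ∷ 1 ∷ 0 ∷ []) ∷
    (1 ∷ 1 ∷ 1 ∷ 2 ∷ 1 ∷ 1 ∷ 1 ∷ 1 ∷ []) ∷
    (1 ∷ 1 ∷ 1 ∷ 2 ∷ 2 ∷ 1 ∷ 1 ∷ 0 ∷ []) ∷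
    (1 ∷ 1 ∷ 2 ∷ 2 ∷ 1 ∷ 1 ∷ 1 ∷ 0 ∷ []) ∷
    (1 ∷ 1 ∷ 2 ∷ 2 ∷ 2 ∷ 1 ∷ 0 ∷ 0 ∷ []) ∷
    (0 ∷ 1 ∷ 1 ∷ 2 ∷ 2 ∷ 2 ∷ 1 ∷ 1 ∷ []) ∷
    (1 ∷ 1 ∷ 1 ∷ 2 ∷ 2 ∷ 1 ∷ 1 ∷ 1 ∷ []) ∷
    (1 ∷ 1 ∷ 1 ∷ 2 ∷ 2 ∷ 2 ∷ 1 ∷ 0 ∷ []) ∷
    (1 ∷ 1 ∷ 2 ∷ 2 ∷ 1 ∷ 1 ∷ 1 ∷ 1 ∷ []) ∷
    (1 ∷ 1 ∷ 2 ∷ 2 ∷ 2 ∷ 1 ∷ 1 ∷ 0 ∷ []) ∷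
    (1 ∷ 1 ∷ 2 ∷ 3 ∷ 2 ∷ 1 ∷ 0 ∷ 0 ∷ []) ∷
    (0 ∷ 1 ∷ 1 ∷ 2 ∷ 2 ∷ 2 ∷ 2 ∷ 1 ∷ []) ∷
    (1 ∷ 1 ∷ 1 ∷ 2 ∷ 2 ∷ 2 ∷ 1 ∷ 1 ∷ []) ∷
    (1 ∷ 1 ∷ 2 ∷ 2 ∷ 2 ∷ 1 ∷ 1 ∷ 1 ∷ []) ∷
    (1 ∷ 1 ∷ 2 ∷ 2 ∷ 2 ∷ 2 ∷ 1 ∷ 0 ∷ []) ∷
    (1 ∷ 1 ∷ 2 ∷ 3 ∷ 2 ∷ 1 ∷ 1 ∷ 0 ∷ []) ∷
    (1 ∷ 2 ∷ 2 ∷ 3 ∷ 2 ∷ 1 ∷ 0 ∷ 0 ∷ []) ∷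
    (1 ∷ 1 ∷ 1 ∷ 2 ∷ 2 ∷ 2 ∷ 2 ∷ 1 ∷ []) ∷
    (1 ∷ 1 ∷ 2 ∷ 2 ∷ 2 ∷ 2 ∷ 1 ∷ 1 ∷ []) ∷
    (1 ∷ 1 ∷ 2 ∷ 3 ∷ 2 ∷ 1 ∷ 1 ∷ 1 ∷ []) ∷
    (1 ∷ 1 ∷ 2 ∷ 3 ∷ 2 ∷ 2 ∷ 1 ∷ 0 ∷ []) ∷
    (1 ∷ 2 ∷ 2 ∷ 3 ∷ 2 ∷ 1 ∷ 1 ∷ 0 ∷ []) ∷
    (1 ∷ 1 ∷ 2 ∷ 2 ∷ 2 ∷ 2 ∷ 2 ∷ 1 ∷ []) ∷
    (1 ∷ 1 ∷ 2 ∷ 3 ∷ 2 ∷ 2 ∷ 1 ∷ 1 ∷ []) ∷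
    (1 ∷ 1 ∷ 2 ∷ 3 ∷ 3 ∷ 2 ∷ 1 ∷ 0 ∷ []) ∷
    (1 ∷ 2 ∷ 2 ∷ 3 ∷ 2 ∷ 1 ∷ 1 ∷ 1 ∷ []) ∷
    (1 ∷ 2 ∷ 2 ∷ 3 ∷ 2 ∷ 2 ∷ 1 ∷ 0 ∷ []) ∷
    (1 ∷ 1 ∷ 2 ∷ 3 ∷ 2 ∷ 2 ∷ 2 ∷ 1 ∷ []) ∷
    (1 ∷ 1 ∷ 2 ∷ 3 ∷ 3 ∷ 2 ∷ 1 ∷ 1 ∷ []) ∷
    (1 ∷ 2 ∷ 2 ∷ 3 ∷ 2 ∷ 2 ∷ 1 ∷ 1 ∷ []) ∷
    (1 ∷ 2 ∷ 2 ∷ 3 ∷ 3 ∷ 2 ∷ 1 ∷ 0 ∷ []) ∷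
    (1 ∷ 1 ∷ 2 ∷ 3 ∷ 3 ∷ 2 ∷ 2 ∷ 1 ∷ []) ∷
    (1 ∷ 2 ∷ 2 ∷ 3 ∷ 2 ∷ 2 ∷ 2 ∷ 1 ∷ []) ∷
    (1 ∷ 2 ∷ 2 ∷ 3 ∷ 3 ∷ 2 ∷ 1 ∷ 1 ∷ []) ∷
    (1 ∷ 2 ∷ 2 ∷ 4 ∷ 3 ∷ 2 ∷ 1 ∷ 0 ∷ []) ∷
    (1 ∷ 1 ∷ 2 ∷ 3 ∷ 3 ∷ 3 ∷ 2 ∷ 1 ∷ []) ∷
    (1 ∷ 2 ∷ 2 ∷ 3 ∷ 3 ∷ 2 ∷ 2 ∷ 1 ∷ []) ∷
    (1 ∷ 2 ∷ 2 ∷ 4 ∷ 3 ∷ 2 ∷ 1 ∷ 1 ∷ []) ∷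
    (1 ∷ 2 ∷ 3 ∷ 4 ∷ 3 ∷ 2 ∷ 1 ∷ 0 ∷ []) ∷
    (1 ∷ 2 ∷ 2 ∷ 3 ∷ 3 ∷ 3 ∷ 2 ∷ 1 ∷ []) ∷
    (1 ∷ 2 ∷ 2 ∷ 4 ∷ 3 ∷ 2 ∷ 2 ∷ 1 ∷ []) ∷
    (1 ∷ 2 ∷ 3 ∷ 4 ∷ 3 ∷ 2 ∷ 1 ∷ 1 ∷ []) ∷
    (2 ∷ 2 ∷ 3 ∷ 4 ∷ 3 ∷ 2 ∷ 1 ∷ 0 ∷ []) ∷
    (1 ∷ 2 ∷ 2 ∷ 4 ∷ 3 ∷ 3 ∷ 2 ∷ 1 ∷ []) ∷
    (1 ∷ 2 ∷ 3 ∷ 4 ∷ 3 ∷ 2 ∷ 2 ∷ 1 ∷ []) ∷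
    (2 ∷ 2 ∷ 3 ∷ 4 ∷ 3 ∷ 2 ∷ 1 ∷ 1 ∷ []) ∷
    (1 ∷ 2 ∷ 2 ∷ 4 ∷ 4 ∷ 3 ∷ 2 ∷ 1 ∷ []) ∷
    (1 ∷ 2 ∷ 3 ∷ 4 ∷ 3 ∷ 3 ∷ 2 ∷ 1 ∷ []) ∷
    (2 ∷ 2 ∷ 3 ∷ 4 ∷ 3 ∷ 2 ∷ 2 ∷ 1 ∷ []) ∷
    (1 ∷ 2 ∷ 3 ∷ 4 ∷ 4 ∷ 3 ∷ 2 ∷ 1 ∷ []) ∷
    (2 ∷ 2 ∷ 3 ∷ 4 ∷ 3 ∷ 3 ∷ 2 ∷ 1 ∷ []) ∷
    (1 ∷ 2 ∷ 3 ∷ 5 ∷ 4 ∷ 3 ∷ 2 ∷ 1 ∷ []) ∷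
    (2 ∷ 2 ∷ 3 ∷ 4 ∷ 4 ∷ 3 ∷ 2 ∷ 1 ∷ []) ∷
    (1 ∷ 3 ∷ 3 ∷ 5 ∷ 4 ∷ 3 ∷ 2 ∷ 1 ∷ []) ∷
    (2 ∷ 2 ∷ 3 ∷ 5 ∷ 4 ∷ 3 ∷ 2 ∷ 1 ∷ []) ∷
    (2 ∷ 2 ∷ 4 ∷ 5 ∷ 4 ∷ 3 ∷ 2 ∷ 1 ∷ []) ∷
    (2 ∷ 3 ∷ 3 ∷ 5 ∷ 4 ∷ 3 ∷ 2 ∷ 1 ∷ []) ∷
    (2 ∷ 3 ∷ 4 ∷ 5 ∷ 4 ∷ 3 ∷ 2 ∷ 1 ∷ []) ∷
    (2 ∷ 3 ∷ 4 ∷ 6 ∷ 4 ∷ 3 ∷ 2 ∷ 1 ∷ []) ∷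
    (2 ∷ 3 ∷ 4 ∷ 6 ∷ 5 ∷ 3 ∷ 2 ∷ 1 ∷ []) ∷
    (2 ∷ 3 ∷ 4 ∷ 6 ∷ 5 ∷ 4 ∷ 2 ∷ 1 ∷ []) ∷
    (2 ∷ 3 ∷ 4 ∷ 6 ∷ 5 ∷ 4 ∷ 3 ∷ 1 ∷ []) ∷
    (2 ∷ 3 ∷ 4 ∷ 6 ∷ 5 ∷ 4 ∷ 3 ∷ 2 ∷ []) ∷
    []

  -- Entry (m, k) is the index of s_k (root m); it is an arbitrary placeholder when root m = α_k.
  reflectionTable : Vec (Vec (Fin 120) 8) 120
  reflectionTable =
    (# 0 ∷ # 0 ∷ # 14 ∷ # 0 ∷ # 0 ∷ # 0 ∷ # 0 ∷ # 0 ∷ []) ∷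
    (# 1 ∷ # 1 ∷ # 1 ∷ # 13 ∷ # 1 ∷ # 1 ∷ # 1 ∷ # 1 ∷ []) ∷
    (# 14 ∷ # 2 ∷ # 2 ∷ # 12 ∷ # 2 ∷ # 2 ∷ # 2 ∷ # 2 ∷ []) ∷
    (# 3 ∷ # 13 ∷ # 12 ∷ # 3 ∷ # 11 ∷ # 3 ∷ # 3 ∷ # 3 ∷ []) ∷
    (# 4 ∷ # 4 ∷ # 4 ∷ # 11 ∷ # 4 ∷ # 10 ∷ # 4 ∷ # 4 ∷ []) ∷
    (# 5 ∷ # 5 ∷ # 5 ∷ # 5 ∷ # 10 ∷ # 5 ∷ # 9 ∷ # 5 ∷ []) ∷
    (# 6 ∷ # 6 ∷ # 6 ∷ # 6 ∷ # 6 ∷ # 9 ∷ # 6 ∷ # 8 ∷ []) ∷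
    (# 7 ∷ # 7 ∷ # 7 ∷ # 7 ∷ # 7 ∷ # 7 ∷ # 8 ∷ # 7 ∷ []) ∷
    (# 8 ∷ # 8 ∷ # 8 ∷ # 8 ∷ # 8 ∷ # 15 ∷ # 7 ∷ # 6 ∷ []) ∷
    (# 9 ∷ # 9 ∷ # 9 ∷ # 9 ∷ # 16 ∷ # 6 ∷ # 5 ∷ # 15 ∷ []) ∷
    (# 10 ∷ # 10 ∷ # 10 ∷ # 17 ∷ # 5 ∷ # 4 ∷ # 16 ∷ # 10 ∷ []) ∷
    (# 11 ∷ # 19 ∷ # 18 ∷ # 4 ∷ # 3 ∷ # 17 ∷ # 11 ∷ # 11 ∷ []) ∷
    (# 21 ∷ # 20 ∷ # 3 ∷ # 2 ∷ # 18 ∷ # 12 ∷ # 12 ∷ # 12 ∷ []) ∷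
    (# 13 ∷ # 3 ∷ # 20 ∷ # 1 ∷ # 19 ∷ # 13 ∷ # 13 ∷ # 13 ∷ []) ∷
    (# 2 ∷ # 14 ∷ # 0 ∷ # 21 ∷ # 14 ∷ # 14 ∷ # 14 ∷ # 14 ∷ []) ∷
    (# 15 ∷ # 15 ∷ # 15 ∷ # 15 ∷ # 22 ∷ # 8 ∷ # 15 ∷ # 9 ∷ []) ∷
    (# 16 ∷ # 16 ∷ # 16 ∷ # 23 ∷ # 9 ∷ # 16 ∷ # 10 ∷ # 22 ∷ []) ∷
    (# 17 ∷ # 25 ∷ # 24 ∷ # 10 ∷ # 17 ∷ # 11 ∷ # 23 ∷ # 17 ∷ []) ∷
    (# 27 ∷ # 26 ∷ # 11 ∷ # 18 ∷ # 12 ∷ # 24 ∷ # 18 ∷ # 18 ∷ []) ∷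
    (# 19 ∷ # 11 ∷ # 26 ∷ # 19 ∷ # 13 ∷ # 25 ∷ # 19 ∷ # 19 ∷ []) ∷
    (# 28 ∷ # 12 ∷ # 13 ∷ # 20 ∷ # 26 ∷ # 20 ∷ # 20 ∷ # 20 ∷ []) ∷
    (# 12 ∷ # 28 ∷ # 21 ∷ # 14 ∷ # 27 ∷ # 21 ∷ # 21 ∷ # 21 ∷ []) ∷
    (# 22 ∷ # 22 ∷ # 22 ∷ # 29 ∷ # 15 ∷ # 22 ∷ # 22 ∷ # 16 ∷ []) ∷
    (# 23 ∷ # 31 ∷ # 30 ∷ # 16 ∷ # 23 ∷ # 23 ∷ # 17 ∷ # 29 ∷ []) ∷
    (# 34 ∷ # 32 ∷ # 17 ∷ # 24 ∷ # 24 ∷ # 18 ∷ # 30 ∷ # 24 ∷ []) ∷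
    (# 25 ∷ # 17 ∷ # 32 ∷ # 25 ∷ # 25 ∷ # 19 ∷ # 31 ∷ # 25 ∷ []) ∷
    (# 35 ∷ # 18 ∷ # 19 ∷ # 33 ∷ # 20 ∷ # 32 ∷ # 26 ∷ # 26 ∷ []) ∷
    (# 18 ∷ # 35 ∷ # 27 ∷ # 27 ∷ # 21 ∷ # 34 ∷ # 27 ∷ # 27 ∷ []) ∷
    (# 20 ∷ # 21 ∷ # 28 ∷ # 28 ∷ # 35 ∷ # 28 ∷ # 28 ∷ # 28 ∷ []) ∷
    (# 29 ∷ # 37 ∷ # 36 ∷ # 22 ∷ # 29 ∷ # 29 ∷ # 29 ∷ # 23 ∷ []) ∷
    (# 40 ∷ # 38 ∷ # 23 ∷ # 30 ∷ # 30 ∷ # 30 ∷ # 24 ∷ # 36 ∷ []) ∷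
    (# 31 ∷ # 23 ∷ # 38 ∷ # 31 ∷ # 31 ∷ # 31 ∷ # 25 ∷ # 37 ∷ []) ∷
    (# 41 ∷ # 24 ∷ # 25 ∷ # 39 ∷ # 32 ∷ # 26 ∷ # 38 ∷ # 32 ∷ []) ∷
    (# 42 ∷ # 33 ∷ # 33 ∷ # 26 ∷ # 33 ∷ # 39 ∷ # 33 ∷ # 33 ∷ []) ∷
    (# 24 ∷ # 41 ∷ # 34 ∷ # 34 ∷ # 34 ∷ # 27 ∷ # 40 ∷ # 34 ∷ []) ∷
    (# 26 ∷ # 27 ∷ # 35 ∷ # 42 ∷ # 28 ∷ # 41 ∷ # 35 ∷ # 35 ∷ []) ∷
    (# 46 ∷ # 43 ∷ # 29 ∷ # 36 ∷ # 36 ∷ # 36 ∷ # 36 ∷ # 30 ∷ []) ∷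
    (# 37 ∷ # 29 ∷ # 43 ∷ # 37 ∷ # 37 ∷ # 37 ∷ # 37 ∷ # 31 ∷ []) ∷
    (# 47 ∷ # 30 ∷ # 31 ∷ # 44 ∷ # 38 ∷ # 38 ∷ # 32 ∷ # 43 ∷ []) ∷
    (# 48 ∷ # 39 ∷ # 39 ∷ # 32 ∷ # 45 ∷ # 33 ∷ # 44 ∷ # 39 ∷ []) ∷
    (# 30 ∷ # 47 ∷ # 40 ∷ # 40 ∷ # 40 ∷ # 40 ∷ # 34 ∷ # 46 ∷ []) ∷
    (# 32 ∷ # 34 ∷ # 41 ∷ # 48 ∷ # 41 ∷ # 35 ∷ # 47 ∷ # 41 ∷ []) ∷
    (# 33 ∷ # 42 ∷ # 49 ∷ # 35 ∷ # 42 ∷ # 48 ∷ # 42 ∷ # 42 ∷ []) ∷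
    (# 52 ∷ # 36 ∷ # 37 ∷ # 50 ∷ # 43 ∷ # 43 ∷ # 43 ∷ # 38 ∷ []) ∷
    (# 53 ∷ # 44 ∷ # 44 ∷ # 38 ∷ # 51 ∷ # 44 ∷ # 39 ∷ # 50 ∷ []) ∷
    (# 54 ∷ # 45 ∷ # 45 ∷ # 45 ∷ # 39 ∷ # 45 ∷ # 51 ∷ # 45 ∷ []) ∷
    (# 36 ∷ # 52 ∷ # 46 ∷ # 46 ∷ # 46 ∷ # 46 ∷ # 46 ∷ # 40 ∷ []) ∷
    (# 38 ∷ # 40 ∷ # 47 ∷ # 53 ∷ # 47 ∷ # 47 ∷ # 41 ∷ # 52 ∷ []) ∷
    (# 39 ∷ # 48 ∷ # 55 ∷ # 41 ∷ # 54 ∷ # 42 ∷ # 53 ∷ # 48 ∷ []) ∷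
    (# 49 ∷ # 49 ∷ # 42 ∷ # 49 ∷ # 49 ∷ # 55 ∷ # 49 ∷ # 49 ∷ []) ∷
    (# 58 ∷ # 50 ∷ # 50 ∷ # 43 ∷ # 56 ∷ # 50 ∷ # 50 ∷ # 44 ∷ []) ∷
    (# 59 ∷ # 51 ∷ # 51 ∷ # 51 ∷ # 44 ∷ # 57 ∷ # 45 ∷ # 56 ∷ []) ∷
    (# 43 ∷ # 46 ∷ # 52 ∷ # 58 ∷ # 52 ∷ # 52 ∷ # 52 ∷ # 47 ∷ []) ∷
    (# 44 ∷ # 53 ∷ # 60 ∷ # 47 ∷ # 59 ∷ # 53 ∷ # 48 ∷ # 58 ∷ []) ∷
    (# 45 ∷ # 54 ∷ # 61 ∷ # 54 ∷ # 48 ∷ # 54 ∷ # 59 ∷ # 54 ∷ []) ∷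
    (# 55 ∷ # 55 ∷ # 48 ∷ # 55 ∷ # 61 ∷ # 49 ∷ # 60 ∷ # 55 ∷ []) ∷
    (# 63 ∷ # 56 ∷ # 56 ∷ # 56 ∷ # 50 ∷ # 62 ∷ # 56 ∷ # 51 ∷ []) ∷
    (# 64 ∷ # 57 ∷ # 57 ∷ # 57 ∷ # 57 ∷ # 51 ∷ # 57 ∷ # 62 ∷ []) ∷
    (# 50 ∷ # 58 ∷ # 65 ∷ # 52 ∷ # 63 ∷ # 58 ∷ # 58 ∷ # 53 ∷ []) ∷
    (# 51 ∷ # 59 ∷ # 66 ∷ # 59 ∷ # 53 ∷ # 64 ∷ # 54 ∷ # 63 ∷ []) ∷
    (# 60 ∷ # 60 ∷ # 53 ∷ # 60 ∷ # 66 ∷ # 60 ∷ # 55 ∷ # 65 ∷ []) ∷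
    (# 61 ∷ # 61 ∷ # 54 ∷ # 67 ∷ # 55 ∷ # 61 ∷ # 66 ∷ # 61 ∷ []) ∷
    (# 69 ∷ # 62 ∷ # 62 ∷ # 62 ∷ # 62 ∷ # 56 ∷ # 68 ∷ # 57 ∷ []) ∷
    (# 56 ∷ # 63 ∷ # 70 ∷ # 63 ∷ # 58 ∷ # 69 ∷ # 63 ∷ # 59 ∷ []) ∷
    (# 57 ∷ # 64 ∷ # 71 ∷ # 64 ∷ # 64 ∷ # 59 ∷ # 64 ∷ # 69 ∷ []) ∷
    (# 65 ∷ # 65 ∷ # 58 ∷ # 65 ∷ # 70 ∷ # 65 ∷ # 65 ∷ # 60 ∷ []) ∷
    (# 66 ∷ # 66 ∷ # 59 ∷ # 72 ∷ # 60 ∷ # 71 ∷ # 61 ∷ # 70 ∷ []) ∷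
    (# 67 ∷ # 73 ∷ # 67 ∷ # 61 ∷ # 67 ∷ # 67 ∷ # 72 ∷ # 67 ∷ []) ∷
    (# 74 ∷ # 68 ∷ # 68 ∷ # 68 ∷ # 68 ∷ # 68 ∷ # 62 ∷ # 68 ∷ []) ∷
    (# 62 ∷ # 69 ∷ # 75 ∷ # 69 ∷ # 69 ∷ # 63 ∷ # 74 ∷ # 64 ∷ []) ∷
    (# 70 ∷ # 70 ∷ # 63 ∷ # 76 ∷ # 65 ∷ # 75 ∷ # 70 ∷ # 66 ∷ []) ∷
    (# 71 ∷ # 71 ∷ # 64 ∷ # 77 ∷ # 71 ∷ # 66 ∷ # 71 ∷ # 75 ∷ []) ∷
    (# 72 ∷ # 78 ∷ # 72 ∷ # 66 ∷ # 72 ∷ # 77 ∷ # 67 ∷ # 76 ∷ []) ∷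
    (# 73 ∷ # 67 ∷ # 73 ∷ # 73 ∷ # 73 ∷ # 73 ∷ # 78 ∷ # 73 ∷ []) ∷
    (# 68 ∷ # 74 ∷ # 79 ∷ # 74 ∷ # 74 ∷ # 74 ∷ # 69 ∷ # 74 ∷ []) ∷
    (# 75 ∷ # 75 ∷ # 69 ∷ # 80 ∷ # 75 ∷ # 70 ∷ # 79 ∷ # 71 ∷ []) ∷
    (# 76 ∷ # 82 ∷ # 76 ∷ # 70 ∷ # 76 ∷ # 80 ∷ # 76 ∷ # 72 ∷ []) ∷
    (# 77 ∷ # 83 ∷ # 77 ∷ # 71 ∷ # 81 ∷ # 72 ∷ # 77 ∷ # 80 ∷ []) ∷
    (# 78 ∷ # 72 ∷ # 78 ∷ # 78 ∷ # 78 ∷ # 83 ∷ # 73 ∷ # 82 ∷ []) ∷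
    (# 79 ∷ # 79 ∷ # 74 ∷ # 84 ∷ # 79 ∷ # 79 ∷ # 75 ∷ # 79 ∷ []) ∷
    (# 80 ∷ # 86 ∷ # 80 ∷ # 75 ∷ # 85 ∷ # 76 ∷ # 84 ∷ # 77 ∷ []) ∷
    (# 81 ∷ # 87 ∷ # 81 ∷ # 81 ∷ # 77 ∷ # 81 ∷ # 81 ∷ # 85 ∷ []) ∷
    (# 82 ∷ # 76 ∷ # 82 ∷ # 82 ∷ # 82 ∷ # 86 ∷ # 82 ∷ # 78 ∷ []) ∷
    (# 83 ∷ # 77 ∷ # 83 ∷ # 83 ∷ # 87 ∷ # 78 ∷ # 83 ∷ # 86 ∷ []) ∷
    (# 84 ∷ # 89 ∷ # 84 ∷ # 79 ∷ # 88 ∷ # 84 ∷ # 80 ∷ # 84 ∷ []) ∷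
    (# 85 ∷ # 90 ∷ # 85 ∷ # 85 ∷ # 80 ∷ # 85 ∷ # 88 ∷ # 81 ∷ []) ∷
    (# 86 ∷ # 80 ∷ # 86 ∷ # 86 ∷ # 90 ∷ # 82 ∷ # 89 ∷ # 83 ∷ []) ∷
    (# 87 ∷ # 81 ∷ # 87 ∷ # 91 ∷ # 83 ∷ # 87 ∷ # 87 ∷ # 90 ∷ []) ∷
    (# 88 ∷ # 93 ∷ # 88 ∷ # 88 ∷ # 84 ∷ # 92 ∷ # 85 ∷ # 88 ∷ []) ∷
    (# 89 ∷ # 84 ∷ # 89 ∷ # 89 ∷ # 93 ∷ # 89 ∷ # 86 ∷ # 89 ∷ []) ∷
    (# 90 ∷ # 85 ∷ # 90 ∷ # 94 ∷ # 86 ∷ # 90 ∷ # 93 ∷ # 87 ∷ []) ∷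
    (# 91 ∷ # 91 ∷ # 95 ∷ # 87 ∷ # 91 ∷ # 91 ∷ # 91 ∷ # 94 ∷ []) ∷
    (# 92 ∷ # 96 ∷ # 92 ∷ # 92 ∷ # 92 ∷ # 88 ∷ # 92 ∷ # 92 ∷ []) ∷
    (# 93 ∷ # 88 ∷ # 93 ∷ # 97 ∷ # 89 ∷ # 96 ∷ # 90 ∷ # 93 ∷ []) ∷
    (# 94 ∷ # 94 ∷ # 98 ∷ # 90 ∷ # 94 ∷ # 94 ∷ # 97 ∷ # 91 ∷ []) ∷
    (# 99 ∷ # 95 ∷ # 91 ∷ # 95 ∷ # 95 ∷ # 95 ∷ # 95 ∷ # 98 ∷ []) ∷
    (# 96 ∷ # 92 ∷ # 96 ∷ # 100 ∷ # 96 ∷ # 93 ∷ # 96 ∷ # 96 ∷ []) ∷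
    (# 97 ∷ # 97 ∷ # 101 ∷ # 93 ∷ # 97 ∷ # 100 ∷ # 94 ∷ # 97 ∷ []) ∷
    (# 102 ∷ # 98 ∷ # 94 ∷ # 98 ∷ # 98 ∷ # 98 ∷ # 101 ∷ # 95 ∷ []) ∷
    (# 95 ∷ # 99 ∷ # 99 ∷ # 99 ∷ # 99 ∷ # 99 ∷ # 99 ∷ # 102 ∷ []) ∷
    (# 100 ∷ # 100 ∷ # 104 ∷ # 96 ∷ # 103 ∷ # 97 ∷ # 100 ∷ # 100 ∷ []) ∷
    (# 105 ∷ # 101 ∷ # 97 ∷ # 101 ∷ # 101 ∷ # 104 ∷ # 98 ∷ # 101 ∷ []) ∷
    (# 98 ∷ # 102 ∷ # 102 ∷ # 102 ∷ # 102 ∷ # 102 ∷ # 105 ∷ # 99 ∷ []) ∷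
    (# 103 ∷ # 103 ∷ # 106 ∷ # 103 ∷ # 100 ∷ # 103 ∷ # 103 ∷ # 103 ∷ []) ∷
    (# 107 ∷ # 104 ∷ # 100 ∷ # 104 ∷ # 106 ∷ # 101 ∷ # 104 ∷ # 104 ∷ []) ∷
    (# 101 ∷ # 105 ∷ # 105 ∷ # 105 ∷ # 105 ∷ # 107 ∷ # 102 ∷ # 105 ∷ []) ∷
    (# 109 ∷ # 106 ∷ # 103 ∷ # 108 ∷ # 104 ∷ # 106 ∷ # 106 ∷ # 106 ∷ []) ∷
    (# 104 ∷ # 107 ∷ # 107 ∷ # 107 ∷ # 109 ∷ # 105 ∷ # 107 ∷ # 107 ∷ []) ∷
    (# 111 ∷ # 110 ∷ # 108 ∷ # 106 ∷ # 108 ∷ # 108 ∷ # 108 ∷ # 108 ∷ []) ∷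
    (# 106 ∷ # 109 ∷ # 109 ∷ # 111 ∷ # 107 ∷ # 109 ∷ # 109 ∷ # 109 ∷ []) ∷
    (# 113 ∷ # 108 ∷ # 110 ∷ # 110 ∷ # 110 ∷ # 110 ∷ # 110 ∷ # 110 ∷ []) ∷
    (# 108 ∷ # 113 ∷ # 112 ∷ # 109 ∷ # 111 ∷ # 111 ∷ # 111 ∷ # 111 ∷ []) ∷
    (# 112 ∷ # 114 ∷ # 111 ∷ # 112 ∷ # 112 ∷ # 112 ∷ # 112 ∷ # 112 ∷ []) ∷
    (# 110 ∷ # 111 ∷ # 114 ∷ # 113 ∷ # 113 ∷ # 113 ∷ # 113 ∷ # 113 ∷ []) ∷
    (# 114 ∷ # 112 ∷ # 113 ∷ # 115 ∷ # 114 ∷ # 114 ∷ # 114 ∷ # 114 ∷ []) ∷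
    (# 115 ∷ # 115 ∷ # 115 ∷ # 114 ∷ # 116 ∷ # 115 ∷ # 115 ∷ # 115 ∷ []) ∷
    (# 116 ∷ # 116 ∷ # 116 ∷ # 116 ∷ # 115 ∷ # 117 ∷ # 116 ∷ # 116 ∷ []) ∷
    (# 117 ∷ # 117 ∷ # 117 ∷ # 117 ∷ # 117 ∷ # 116 ∷ # 118 ∷ # 117 ∷ []) ∷
    (# 118 ∷ # 118 ∷ # 118 ∷ # 118 ∷ # 118 ∷ # 118 ∷ # 117 ∷ # 119 ∷ []) ∷
    (# 119 ∷ # 119 ∷ # 119 ∷ # 119 ∷ # 119 ∷ # 119 ∷ # 119 ∷ # 118 ∷ []) ∷
    []

  root : Fin 120 → Vec8
  root m i = + lookup (lookup positiveRoots m) i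

  next : Fin 120 → Fin 8 → Fin 120
  next m k = lookup (lookup reflectionTable m) k

  root-IsPos : ∀ m → IsPos (root m)
  root-IsPos m i = +≤+ ℕ.z≤n

  simple-in-table : ∀ j → e j ≐ root (j ↑ˡ 112)
  simple-in-table = toWitness {a? = all? λ j → e j ≐? root (j ↑ˡ 112)} tt

  table-closed : ∀ m k → root m ≐ e k ⊎ srₑ k (root m) ≐ root (next m k)
  table-closed = toWitness {a? = all? λ m → all? λ k → (root m ≐? e k) ⊎-dec (srₑ k (root m) ≐? root (next m k))} tt

  table-nonsimple : ∀ m → (∃ λ j → root m ≐ e j) ⊎ (∃ λ j → Bₑ (root m) j ≡ + 1)
  table-nonsimple = toWitness {a? = all? λ m → any? (λ j → root m ≐? e j) ⊎-dec any? (λ j → Bₑ (root m) j ℤ.≟ + 1)} tt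

  table-pairing : ∀ m k → root m ≐ e k ⊎ - + 1 ≤ Bₑ (root m) k
  table-pairing = toWitness {a? = all? λ m → all? λ k → (root m ≐? e k) ⊎-dec (- + 1 ≤? Bₑ (root m) k)} tt

±Root : Vec8 → Set
±Root x = ∃ λ m → x ≐ root m ⊎ x ≐ neg (root m)

±Root-resp : ∀ {x y} → x ≐ y → ±Root x → ±Root y
±Root-resp x≐y (m , inj₁ x≐r) = m , inj₁ (≐-trans (≐-sym x≐y) x≐r)
±Root-resp x≐y (m , inj₂ x≐-r) = m , inj₂ (≐-trans (≐-sym x≐y) x≐-r)

±Root-neg : ∀ {x} → ±Root x → ±Root (neg x)
±Root-neg (m , inj₁ x≐r) = m , inj₂ (λ i → cong -_ (x≐r i))
±Root-neg (m , inj₂ x≐-r) = m , inj₁ (λ i → trans (cong -_ (x≐-r i)) (ℤ.neg-involutive (root m i)))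

sr-root : ∀ k m → ±Root (sr k (root m))
sr-root k m with table-closed m k
... | inj₁ rₘ≐αₖ = k ↑ˡ 112 , inj₂ (≐-trans (reflect-congʳ (e k) rₘ≐αₖ)
                                 (≐-trans (reflect-self (e k) (B-eₖ-eₖ k)) (λ i → cong -_ (simple-in-table k i))))
... | inj₂ sₖrₘ≐r = next m k , inj₁ (≐-trans (≐-sym (srₑ≐sr k (root m))) sₖrₘ≐r)

sr-±Root : ∀ k {x} → ±Root x → ±Root (sr k x)
sr-±Root k (m , inj₁ x≐r)  = ±Root-resp (reflect-congʳ (e k) (≐-sym x≐r)) (sr-root k m)
sr-±Root k (m , inj₂ x≐-r) =
  ±Root-resp (≐-trans (≐-sym (preserves-neg (reflect-isLinear (e k)) (root m))) (reflect-congʳ (e k) (≐-sym x≐-r)))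
             (±Root-neg (sr-root k m))

IsRoot⇒±Root : ∀ {β} → IsRoot β → ±Root β
IsRoot⇒±Root (w , j , wαⱼ≐β) = ±Root-resp wαⱼ≐β (go w)
  where
  go : ∀ w → ±Root (⟦ w ⟧ (e j))
  go []      = j ↑ˡ 112 , inj₁ (simple-in-table j)
  go (k ∷ w) = sr-±Root k (go w)

root-sign : ∀ {β} → IsRoot β → IsPos β ⊎ IsNeg β
root-sign r with IsRoot⇒±Root r
... | m , inj₁ β≐r  = inj₁ (IsPos-resp (≐-sym β≐r) (root-IsPos m))
... | m , inj₂ β≐-r = inj₂ (IsNeg-resp (≐-sym β≐-r) (neg-IsPos (root-IsPos m)))

root-not-pos-and-neg : ∀ {β} → IsRoot β → IsPos β → IsNeg β → ⊥
root-not-pos-and-neg {β} r β≥0 β≤0 = 2≢0 (trans (sym (B-root r)) (B-cong β≐0 β≐0))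
  where
  β≐0 : β ≐ (λ _ → + 0)
  β≐0 i = ℤ.≤-antisym (β≤0 i) (β≥0 i)
  2≢0 : + 2 ≢ + 0
  2≢0 ()

¬IsNeg⇒IsPos : ∀ {β} → IsRoot β → ¬ IsNeg β → IsPos β
¬IsNeg⇒IsPos r β≰0 = [ (λ β≥0 → β≥0) , (λ β≤0 → ⊥-elim (β≰0 β≤0)) ]′ (root-sign r)

¬IsPos⇒IsNeg : ∀ {β} → IsRoot β → ¬ IsPos β → IsNeg β
¬IsPos⇒IsNeg r β≱0 = [ (λ β≥0 → ⊥-elim (β≱0 β≥0)) , (λ β≤0 → β≤0) ]′ (root-sign r)

PosRoot⇒table : ∀ {β} → PosRoot β → ∃ λ m → β ≐ root m
PosRoot⇒table (r , β≥0) with IsRoot⇒±Root r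
... | m , inj₁ β≐r  = m , β≐r
... | m , inj₂ β≐-r = ⊥-elim (root-not-pos-and-neg r β≥0 (IsNeg-resp (≐-sym β≐-r) (neg-IsPos (root-IsPos m))))

sr-IsPos : ∀ {β} k → PosRoot β → ¬ β ≐ e k → IsPos (sr k β)
sr-IsPos k pr β≢αₖ with PosRoot⇒table pr
... | m , β≐r with table-closed m k
...   | inj₁ r≐αₖ  = ⊥-elim (β≢αₖ (≐-trans β≐r r≐αₖ))
...   | inj₂ sₖr≐r' = IsPos-resp (≐-trans (≐-sym sₖr≐r') (≐-trans (srₑ≐sr k (root m)) (reflect-congʳ (e k) (≐-sym β≐r))))
                                 (root-IsPos (next m k))

B-e-table : ∀ {β} m k → β ≐ root m → B β (e k) ≡ Bₑ (root m) k
B-e-table {β} m k β≐r = trans (B-congˡ (e k) β≐r) (B-e (root m) k)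

B-e-lower-bound : ∀ {β} k → PosRoot β → ¬ β ≐ e k → - + 1 ≤ B β (e k)
B-e-lower-bound k pr β≢αₖ with PosRoot⇒table pr
... | m , β≐r with table-pairing m k
...   | inj₁ r≐αₖ = ⊥-elim (β≢αₖ (≐-trans β≐r r≐αₖ))
...   | inj₂ -1≤b = subst (- + 1 ≤_) (sym (B-e-table m k β≐r)) -1≤b

nonsimple-B-e≡1 : ∀ {β} → PosRoot β → ¬ IsSimpleRoot β → ∃ λ j → B β (e j) ≡ + 1
nonsimple-B-e≡1 pr β-nonsimple with PosRoot⇒table pr
... | m , β≐r with table-nonsimple m
...   | inj₁ (j , r≐αⱼ) = ⊥-elim (β-nonsimple (j , ≐-trans β≐r r≐αⱼ))
...   | inj₂ (j , b≡1)  = j , trans (B-e-table m j β≐r) b≡1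

sr-negates-only-αₖ : ∀ {β} k → PosRoot β → IsNeg (sr k β) → β ≐ e k
sr-negates-only-αₖ {β} k pr sₖβ≤0 with β ≐? e k
... | yes β≐αₖ = β≐αₖ
... | no  β≢αₖ = ⊥-elim (root-not-pos-and-neg (InW-IsRoot (sr-InW k) (proj₁ pr)) (sr-IsPos k pr β≢αₖ) sₖβ≤0)

-- Length and the sign of f β

strong-exchange : ∀ w {β} → PosRoot β → IsNeg (⟦ w ⟧ β) →
                  ∃ λ w' → length w' ℕ.< length w × ⟦ w' ⟧ ≈ (⟦ w ⟧ ∘ reflect β)
strong-exchange []      (r , β≥0) β≤0 = ⊥-elim (root-not-pos-and-neg r β≥0 β≤0)
strong-exchange (k ∷ w) {β} pr@(r , _) kwβ≤0 = by-sign (root-sign (InW-IsRoot (w , ≈-refl) r))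
  where
  by-sign : IsPos (⟦ w ⟧ β) ⊎ IsNeg (⟦ w ⟧ β) →
            ∃ λ w' → length w' ℕ.< suc (length w) × ⟦ w' ⟧ ≈ (⟦ k ∷ w ⟧ ∘ reflect β)
  by-sign (inj₁ wβ≥0) = w , ℕ.n<1+n (length w) , λ x → ≐-sym (cancel x)
    where
    wβ≐αₖ : ⟦ w ⟧ β ≐ e k
    wβ≐αₖ = sr-negates-only-αₖ k (InW-IsRoot (w , ≈-refl) r , wβ≥0) kwβ≤0
    cancel : ∀ x → sr k (⟦ w ⟧ (reflect β x)) ≐ ⟦ w ⟧ x
    cancel x i = begin
      sr k (⟦ w ⟧ (reflect β x)) i                 ≡⟨ reflect-congʳ (e k) (⟦⟧-conj w β x) i ⟩
      sr k (reflect (⟦ w ⟧ β) (⟦ w ⟧ x)) i         ≡⟨ reflect-congʳ (e k) (reflect-congˡ wβ≐αₖ (⟦ w ⟧ x)) i ⟩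
      sr k (sr k (⟦ w ⟧ x)) i                      ≡⟨ reflect-involutive (e k) (⟦ w ⟧ x) (B-eₖ-eₖ k) i ⟩
      ⟦ w ⟧ x i                                    ∎
  by-sign (inj₂ wβ≤0) =
    let w' , |w'|<|w| , w'≈wt = strong-exchange w pr wβ≤0
    in  k ∷ w' , ℕ.s≤s |w'|<|w| , λ x → reflect-congʳ (e k) (w'≈wt x)

reflect-shortens : ∀ {f β} → InW f → PosRoot β → IsNeg (f β) → Shorter (f ∘ reflect β) f
reflect-shortens {f} {β} f∈W pr fβ≤0 =
  let n , (w , |w|≡n , w≈f) , n-minimal = InW-length f∈W
      w' , |w'|<|w| , w'≈wt = strong-exchange w pr (IsNeg-resp (λ i → sym (w≈f β i)) fβ≤0)
      m , ℓw'@(_ , m-minimal) = length-exists w'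
  in  m , n ,
      HasLength-resp-≈ (λ x → ≐-trans (w'≈wt x) (w≈f (reflect β x))) ℓw' ,
      ((w , |w|≡n , w≈f) , n-minimal) ,
      ℕ.≤-<-trans (m-minimal w' ≈-refl) (subst (length w' ℕ.<_) |w|≡n |w'|<|w|)

reflect-twice : ∀ {f β} → InW f → IsRoot β → (f ∘ reflect β ∘ reflect β) ≈ f
reflect-twice f∈W r x = preserves-≐ (InW-isLinear f∈W) (reflect-involutive _ x (B-root r))

image-reflect-self : ∀ {f β} → InW f → IsRoot β → f (reflect β β) ≐ neg (f β)
image-reflect-self {f} {β} f∈W r =
  ≐-trans (preserves-≐ (InW-isLinear f∈W) (reflect-self β (B-root r))) (preserves-neg (InW-isLinear f∈W) β)

reflect-lengthens : ∀ {f β} → InW f → PosRoot β → IsPos (f β) → Shorter f (f ∘ reflect β)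
reflect-lengthens {f} {β} f∈W pr@(r , _) fβ≥0 =
  Shorter-resp-≈ (reflect-twice f∈W r) ≈-refl
    (reflect-shortens (InW-∘ f∈W (reflect-InW r)) pr
      (IsNeg-resp (≐-sym (image-reflect-self f∈W r)) (neg-IsPos fβ≥0)))

<ᴮ⇒Shorter : ∀ {f g} → f <ᴮ g → Shorter f g
<ᴮ⇒Shorter [ _ , _ , _ , f<g ]          = f<g
<ᴮ⇒Shorter ((_ , _ , _ , f<g) ∷ g<ᴮh) = Shorter-trans f<g (<ᴮ⇒Shorter g<ᴮh)

IsPos⇒A : ∀ {f β} → InW f → PosRoot β → IsPos (f β) → A f β
IsPos⇒A {β = β} f∈W pr fβ≥0 = pr , [ β , pr , ≈-refl , reflect-lengthens f∈W pr fβ≥0 ]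

IsNeg⇒D : ∀ {f β} → InW f → PosRoot β → IsNeg (f β) → D f β
IsNeg⇒D {β = β} f∈W pr@(r , _) fβ≤0 =
  pr , [ β , pr , ≈-sym (reflect-twice f∈W r) , reflect-shortens f∈W pr fβ≤0 ]

A⇒IsPos : ∀ {f β} → InW f → A f β → IsPos (f β)
A⇒IsPos f∈W (pr@(r , _) , f<ft) =
  ¬IsNeg⇒IsPos (InW-IsRoot f∈W r) (Shorter-asym (<ᴮ⇒Shorter f<ft) ∘ reflect-shortens f∈W pr)

D⇒IsNeg : ∀ {f β} → InW f → D f β → IsNeg (f β)
D⇒IsNeg f∈W (pr@(r , _) , ft<f) =
  ¬IsPos⇒IsNeg (InW-IsRoot f∈W r) (Shorter-asym (<ᴮ⇒Shorter ft<f) ∘ reflect-lengthens f∈W pr)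

IsNeg⇒DR : ∀ {f j} → InW f → IsNeg (f (e j)) → DR f j
IsNeg⇒DR f∈W = reflect-shortens f∈W (e-PosRoot _)

DR⇒IsNeg : ∀ {f j} → InW f → DR f j → IsNeg (f (e j))
DR⇒IsNeg {j = j} f∈W fsⱼ<f =
  ¬IsPos⇒IsNeg (InW-IsRoot f∈W (proj₁ (e-PosRoot j))) (Shorter-asym fsⱼ<f ∘ reflect-lengthens f∈W (e-PosRoot j))

-- Minimal elements of AD(u, v)

module MinimalInAD {U V : Map} (U∈W : InW U) (V∈W : InW V) {β : Vec8} (β-minimal : MinimalIn (AD U V) β)
                   {j : Fin 8} (Bβαⱼ≡1 : B β (e j) ≡ + 1) (β≢αⱼ : ¬ β ≐ e j) where

  private
    β-PosRoot : PosRoot β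
    β-PosRoot = proj₁ (proj₁ (proj₁ β-minimal))

    Uβ≥0 : IsPos (U β)
    Uβ≥0 = A⇒IsPos U∈W (proj₁ (proj₁ β-minimal))

    Vβ≤0 : IsNeg (V β)
    Vβ≤0 = D⇒IsNeg V∈W (proj₂ (proj₁ β-minimal))

    β-least : ∀ δ → AD U V δ → δ ⪯ β → δ ≐ β
    β-least = proj₂ β-minimal

    Bαⱼβ≡1 : B (e j) β ≡ + 1
    Bαⱼβ≡1 = trans (B-sym (e j) β) Bβαⱼ≡1

    β-sⱼβ≡αⱼ : ∀ i → β i - sr j β i ≡ e j i
    β-sⱼβ≡αⱼ i = trans (cong (_-_ (β i)) (reflect-B≡1 (e j) β Bβαⱼ≡1 i)) (cancel (β i) (e j i))
      where
      cancel : ∀ p q → p - (p - q) ≡ q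
      cancel = solve-∀

  sⱼβ-PosRoot : PosRoot (sr j β)
  sⱼβ-PosRoot = InW-IsRoot (sr-InW j) (proj₁ β-PosRoot) , sr-IsPos j β-PosRoot β≢αⱼ

  sⱼβ⪯β : sr j β ⪯ β
  sⱼβ⪯β i = subst (+ 0 ≤_) (sym (β-sⱼβ≡αⱼ i)) (e-IsPos j i)

  αⱼ⪯β : e j ⪯ β
  αⱼ⪯β i = subst (+ 0 ≤_) (reflect-B≡1 (e j) β Bβαⱼ≡1 i) (proj₂ sⱼβ-PosRoot i)

  sⱼβ≢β : ¬ sr j β ≐ β
  sⱼβ≢β sⱼβ≐β = 1≢0 (begin
    + 1                ≡⟨ e-diag j ⟨
    e j j              ≡⟨ β-sⱼβ≡αⱼ j ⟨
    β j - sr j β j     ≡⟨ cong (_-_ (β j)) (sⱼβ≐β j) ⟩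
    β j - β j          ≡⟨ ℤ.+-inverseʳ (β j) ⟩
    + 0                ∎)
    where
    1≢0 : + 1 ≢ + 0
    1≢0 ()

  image-sⱼβ : ∀ {f} → InW f → f (sr j β) ≐ f β ⊖ f (e j)
  image-sⱼβ f∈W =
    ≐-trans (preserves-≐ (InW-isLinear f∈W) (reflect-B≡1 (e j) β Bβαⱼ≡1)) (preserves-⊖ (InW-isLinear f∈W) β (e j))

  Uαⱼ≤0⇒¬Vαⱼ≥0 : IsNeg (U (e j)) → IsPos (V (e j)) → ⊥
  Uαⱼ≤0⇒¬Vαⱼ≥0 Uαⱼ≤0 Vαⱼ≥0 = sⱼβ≢β (β-least (sr j β) (sⱼβ∈A , sⱼβ∈D) sⱼβ⪯β)
    where
    sⱼβ∈A : A U (sr j β)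
    sⱼβ∈A = IsPos⇒A U∈W sⱼβ-PosRoot (IsPos-resp (≐-sym (image-sⱼβ U∈W)) (⊖-IsPos Uβ≥0 Uαⱼ≤0))
    sⱼβ∈D : D V (sr j β)
    sⱼβ∈D = IsNeg⇒D V∈W sⱼβ-PosRoot (IsNeg-resp (≐-sym (image-sⱼβ V∈W)) (⊖-IsNeg Vβ≤0 Vαⱼ≥0))

  DR-U⇒DR-V : DR U j → DR V j
  DR-U⇒DR-V sⱼ∈DR[U] =
    IsNeg⇒DR V∈W (¬IsPos⇒IsNeg (InW-IsRoot V∈W (proj₁ (e-PosRoot j))) (Uαⱼ≤0⇒¬Vαⱼ≥0 (DR⇒IsNeg U∈W sⱼ∈DR[U])))

  DR-V⇒DR-U : DR V j → DR U j
  DR-V⇒DR-U sⱼ∈DR[V] = IsNeg⇒DR U∈W (¬IsPos⇒IsNeg (InW-IsRoot U∈W (proj₁ (e-PosRoot j))) αⱼ∉A)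
    where
    αⱼ∉A : ¬ IsPos (U (e j))
    αⱼ∉A Uαⱼ≥0 = β≢αⱼ (≐-sym (β-least (e j) (IsPos⇒A U∈W (e-PosRoot j) Uαⱼ≥0 , IsNeg⇒D V∈W (e-PosRoot j) (DR⇒IsNeg V∈W sⱼ∈DR[V])) αⱼ⪯β))

  sⱼβ-minimal : MinimalIn (AD (U ∘ sr j) (V ∘ sr j)) (sr j β)
  sⱼβ-minimal = (sⱼβ∈A , sⱼβ∈D) , least
    where
    Usⱼ∈W : InW (U ∘ sr j)
    Usⱼ∈W = InW-∘ U∈W (sr-InW j)
    Vsⱼ∈W : InW (V ∘ sr j)
    Vsⱼ∈W = InW-∘ V∈W (sr-InW j)

    sⱼsⱼβ : ∀ {f} → InW f → f (sr j (sr j β)) ≐ f β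
    sⱼsⱼβ f∈W = preserves-≐ (InW-isLinear f∈W) (reflect-involutive (e j) β (B-eₖ-eₖ j))

    sⱼβ∈A : A (U ∘ sr j) (sr j β)
    sⱼβ∈A = IsPos⇒A Usⱼ∈W sⱼβ-PosRoot (IsPos-resp (≐-sym (sⱼsⱼβ U∈W)) Uβ≥0)
    sⱼβ∈D : D (V ∘ sr j) (sr j β)
    sⱼβ∈D = IsNeg⇒D Vsⱼ∈W sⱼβ-PosRoot (IsNeg-resp (≐-sym (sⱼsⱼβ V∈W)) Vβ≤0)

    least : ∀ δ → AD (U ∘ sr j) (V ∘ sr j) δ → δ ⪯ sr j β → δ ≐ sr j β
    least δ (δ∈A , δ∈D) δ⪯sⱼβ = by-cases (δ ≐? e j)
      where
      by-cases : Dec (δ ≐ e j) → δ ≐ sr j β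
      by-cases (yes δ≐αⱼ) = ⊥-elim (Uαⱼ≤0⇒¬Vαⱼ≥0 Uαⱼ≤0 Vαⱼ≥0)
        where
        image-sⱼδ : ∀ {f} → InW f → f (sr j δ) ≐ neg (f (e j))
        image-sⱼδ f∈W = ≐-trans (preserves-≐ (InW-isLinear f∈W) (≐-trans (reflect-congʳ (e j) δ≐αⱼ) (reflect-self (e j) (B-eₖ-eₖ j))))
                                (preserves-neg (InW-isLinear f∈W) (e j))
        Uαⱼ≤0 : IsNeg (U (e j))
        Uαⱼ≤0 = IsNeg-resp (neg-involutive _) (neg-IsPos (IsPos-resp (image-sⱼδ U∈W) (A⇒IsPos Usⱼ∈W δ∈A)))
        Vαⱼ≥0 : IsPos (V (e j))
        Vαⱼ≥0 = IsPos-resp (neg-involutive _) (neg-IsNeg (IsNeg-resp (image-sⱼδ V∈W) (D⇒IsNeg Vsⱼ∈W δ∈D)))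
      by-cases (no δ≢αⱼ) = ≐-trans (≐-sym (reflect-involutive (e j) δ (B-eₖ-eₖ j))) (reflect-congʳ (e j) sⱼδ≐β)
        where
        δ-PosRoot : PosRoot δ
        δ-PosRoot = proj₁ δ∈A
        sⱼδ-PosRoot : PosRoot (sr j δ)
        sⱼδ-PosRoot = InW-IsRoot (sr-InW j) (proj₁ δ-PosRoot) , sr-IsPos j δ-PosRoot δ≢αⱼ
        1+Bδαⱼ≥0 : + 0 ≤ + 1 + B δ (e j)
        1+Bδαⱼ≥0 = ℤ.+-monoʳ-≤ (+ 1) (B-e-lower-bound j δ-PosRoot δ≢αⱼ)
        sⱼδ⪯β : sr j δ ⪯ β
        sⱼδ⪯β i = subst (+ 0 ≤_) (sym (gap i)) (ℤ.+-mono-≤ (δ⪯sⱼβ i) (*-nonNeg 1+Bδαⱼ≥0 (e-IsPos j i)))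
          where
          gap : ∀ i → β i - sr j δ i ≡ (sr j β i - δ i) + (+ 1 + B δ (e j)) * e j i
          gap i = trans (rearrange (β i) (δ i) (B δ (e j)) (e j i)) (cong (λ c → (c - δ i) + (+ 1 + B δ (e j)) * e j i) (sym (reflect-B≡1 (e j) β Bβαⱼ≡1 i)))
            where
            rearrange : ∀ p d b q → p - (d - b * q) ≡ ((p - q) - d) + (+ 1 + b) * q
            rearrange = solve-∀
        sⱼδ≐β : sr j δ ≐ β
        sⱼδ≐β = β-least (sr j δ) (IsPos⇒A U∈W sⱼδ-PosRoot (A⇒IsPos Usⱼ∈W δ∈A) , IsNeg⇒D V∈W sⱼδ-PosRoot (D⇒IsNeg Vsⱼ∈W δ∈D)) sⱼδ⪯β

  αⱼ∈D[tβ] : D (reflect β) (e j)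
  αⱼ∈D[tβ] = IsNeg⇒D (reflect-InW (proj₁ β-PosRoot)) (e-PosRoot j)
                     (IsNeg-resp (≐-sym (reflect-swap β (e j) Bαⱼβ≡1)) (neg-IsPos (proj₂ sⱼβ-PosRoot)))

  tsⱼβ≈tβsⱼtβ : reflect (sr j β) ≈ (reflect β ∘ sr j ∘ reflect β)
  tsⱼβ≈tβsⱼtβ x = ≐-sym (≐-trans (reflect-conjugate β (e j) (B-root (proj₁ β-PosRoot)) x)
                                  (≐-trans (reflect-congˡ (reflect-swap β (e j) Bαⱼβ≡1) x) (reflect-neg (sr j β) x)))

  tβsⱼtβ≈sⱼtβsⱼ : (reflect β ∘ sr j ∘ reflect β) ≈ (sr j ∘ reflect β ∘ sr j)
  tβsⱼtβ≈sⱼtβsⱼ = ≈-trans (≈-sym tsⱼβ≈tβsⱼtβ) (≈-sym (reflect-conjugate (e j) β (B-eₖ-eₖ j)))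

proposition4p10 : (u v : List (Fin 8)) (β : Vec8) →
    MinimalIn (AD ⟦ u ⟧ ⟦ v ⟧) β → ¬ IsSimpleRoot β →
    ∃ λ j →
      D (reflect β) (e j)
      × (∃ λ γ → (reflect γ ≈ (reflect β ∘ sr j ∘ reflect β))
                 × MinimalIn (AD (⟦ u ⟧ ∘ sr j) (⟦ v ⟧ ∘ sr j)) γ)
      × ((reflect β ∘ sr j ∘ reflect β) ≈ (sr j ∘ reflect β ∘ sr j))
      × ((DR ⟦ u ⟧ j → DR ⟦ v ⟧ j) × (DR ⟦ v ⟧ j → DR ⟦ u ⟧ j))
proposition4p10 u v β β-minimal β-nonsimple =
  map₂ (λ {j} Bβαⱼ≡1 →
          let open MinimalInAD (u , ≈-refl) (v , ≈-refl) β-minimal Bβαⱼ≡1 (λ β≐αⱼ → β-nonsimple (j , β≐αⱼ))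
          in  αⱼ∈D[tβ] , (sr j β , tsⱼβ≈tβsⱼtβ , sⱼβ-minimal) , tβsⱼtβ≈sⱼtβsⱼ , DR-U⇒DR-V , DR-V⇒DR-U)
       (nonsimple-B-e≡1 (proj₁ (proj₁ (proj₁ β-minimal))) β-nonsimple)
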